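{- Let $A,C\ge 2$ and $t\ge 1$ be integers, and put $\varphi=\frac{1+\sqrt5}{2}$, $$L_{A,t,C}=1-\tfrac{3}{\sqrt5}\varphi^{ -t}+\Big(1-\tfrac{3}{\sqrt5}\varphi^{t}\Big)\big(\varphi^{ -2t-2A}+\varphi^{2A-2C}\big)-\Big(6+\tfrac{3}{\sqrt5}\varphi^{t}+\tfrac{9}{\sqrt5}\Big)\varphi^{ -2C},$$ $$U_{A,t,C}=1-\tfrac{3}{\sqrt5}\varphi^{ -t}+\Big(1+\tfrac{3}{\sqrt5}\varphi^{t}\Big)\big(\varphi^{ -2t-2A}+\varphi^{2A-2C}\big)+9\varphi^{ -2C}.$$ If $a,b,c$ are integers with $A\le a\le b\le c=a+b+t$ and $c\ge C$, then $$L_{A,t,C}\,\tfrac15\varphi^{2c}\le F(a)^2+F(b)^2+F(c)^2-3F(a)F(b)F(c)\le U_{A,t,C}\,\tfrac15\varphi^{2c}.$$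
   Context: $F(n)$ denotes the $n$-th Fibonacci number, $F(0)=0$, $F(1)=1$, $F(n+1)=F(n)+F(n-1)$. -}

module Defs where

-- The real numbers occurring in the statement all lie in the real quadratic
-- field Q(√5).  We model Q(√5) ⊂ ℝ exactly: p + q√5 with p q : ℚ, with the
-- field operations and the order inherited from ℝ (√5 > 0).

open import Data.Nat as ℕ using (ℕ; zero; suc)
open import Data.Integer as ℤ using (ℤ; +_; -[1+_])
open import Data.Rational as ℚ using (ℚ; 0ℚ; 1ℚ; ½; -½)
open import Data.Product using (_×_)
open import Data.Sum using (_⊎_)

F : ℕ → ℕ
F zero = 0
F (suc zero) = 1
F (suc (suc n)) = F (suc n) ℕ.+ F n

record ℚ√5 : Set where
  constructor _+_√5
  field
    re : ℚ
    im : ℚ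
open ℚ√5 public

infixl 6 _⊕_ _⊖_
infixl 7 _⊗_

_⊕_ : ℚ√5 → ℚ√5 → ℚ√5
(p + q √5) ⊕ (r + s √5) = (p ℚ.+ r) + (q ℚ.+ s) √5

⊝_ : ℚ√5 → ℚ√5
⊝ (p + q √5) = (ℚ.- p) + (ℚ.- q) √5

_⊖_ : ℚ√5 → ℚ√5 → ℚ√5
x ⊖ y = x ⊕ (⊝ y)

_⊗_ : ℚ√5 → ℚ√5 → ℚ√5
(p + q √5) ⊗ (r + s √5) =
  (p ℚ.* r ℚ.+ (ℤ.+ 5 ℚ./ 1) ℚ.* (q ℚ.* s)) + (p ℚ.* s ℚ.+ q ℚ.* r) √5

ofℚ : ℚ → ℚ√5
ofℚ p = p + 0ℚ √5

ofℤ : ℤ → ℚ√5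
ofℤ z = ofℚ (z ℚ./ 1)

φ : ℚ√5
φ = ½ + ½ √5

φ⁻¹ : ℚ√5
φ⁻¹ = -½ + ½ √5

_^_ : ℚ√5 → ℕ → ℚ√5
x ^ zero = 1ℚ + 0ℚ √5
x ^ suc n = x ⊗ (x ^ n)

φ^ : ℤ → ℚ√5
φ^ (+ n) = φ ^ n
φ^ (-[1+ n ]) = φ⁻¹ ^ suc n

3/√5 : ℚ√5
3/√5 = 0ℚ + (ℤ.+ 3 ℚ./ 5) √5

9/√5 : ℚ√5
9/√5 = 0ℚ + (ℤ.+ 9 ℚ./ 5) √5

-- the real order restricted to Q(√5):  p + q√5 ≥ 0  (as a real number)
NonNeg : ℚ√5 → Set
NonNeg (p + q √5) =
    (0ℚ ℚ.≤ p × 0ℚ ℚ.≤ q)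
  ⊎ (0ℚ ℚ.≤ p × q ℚ.< 0ℚ × (ℤ.+ 5 ℚ./ 1) ℚ.* (q ℚ.* q) ℚ.≤ p ℚ.* p)
  ⊎ (p ℚ.< 0ℚ × 0ℚ ℚ.< q × p ℚ.* p ℚ.≤ (ℤ.+ 5 ℚ./ 1) ℚ.* (q ℚ.* q))

infix 4 _≤√_
_≤√_ : ℚ√5 → ℚ√5 → Set
x ≤√ y = NonNeg (y ⊖ x)

one : ℚ√5
one = ofℚ 1ℚ

L : ℕ → ℕ → ℕ → ℚ√5
L A t C =
  one ⊖ 3/√5 ⊗ φ^ (ℤ.- (+ t))
  ⊕ (one ⊖ 3/√5 ⊗ φ^ (+ t))
      ⊗ (φ^ (ℤ.- (+ (2 ℕ.* t ℕ.+ 2 ℕ.* A))) ⊕ φ^ ((+ (2 ℕ.* A)) ℤ.- (+ (2 ℕ.* C))))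
  ⊖ (ofℤ (+ 6) ⊕ 3/√5 ⊗ φ^ (+ t) ⊕ 9/√5) ⊗ φ^ (ℤ.- (+ (2 ℕ.* C)))

U : ℕ → ℕ → ℕ → ℚ√5
U A t C =
  one ⊖ 3/√5 ⊗ φ^ (ℤ.- (+ t))
  ⊕ (one ⊕ 3/√5 ⊗ φ^ (+ t))
      ⊗ (φ^ (ℤ.- (+ (2 ℕ.* t ℕ.+ 2 ℕ.* A))) ⊕ φ^ ((+ (2 ℕ.* A)) ℤ.- (+ (2 ℕ.* C))))
  ⊕ ofℤ (+ 9) ⊗ φ^ (ℤ.- (+ (2 ℕ.* C)))

Q : ℕ → ℕ → ℕ → ℤ
Q a b c = (+ (F a ℕ.* F a ℕ.+ F b ℕ.* F b ℕ.+ F c ℕ.* F c))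
          ℤ.- (+ (3 ℕ.* F a ℕ.* F b ℕ.* F c))

fifthφ2 : ℕ → ℚ√5
fifthφ2 c = ofℚ (ℤ.+ 1 ℚ./ 5) ⊗ (φ ^ (2 ℕ.* c))

module Submission where

-- By Binet's formula, √5 F(n) = φⁿ − (−1)ⁿ φ⁻ⁿ. Put X = φᵃ, Y = φᵇ, T = φᵗ, so that φᶜ = XYT.
-- Expanding 5Q = x² + y² + z² − (3/√5) x y z at x = √5 F(a), y = √5 F(b), z = √5 F(c) gives
--   5Q = φ²ᶜ (1 − (3/√5) φ⁻ᵗ) + X² (1 + (3/√5) (−1)ᵇ T) + Y² (1 + (3/√5) (−1)ᵃ T) + R,
-- where R is bounded by an absolute constant apart from one term ±(3/√5) T. Since A ≤ a ≤ b and C ≤ c,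
-- X² + Y² ≤ φ²ᶜ (φ^(−2t−2A) + φ^(2A−2C)) and φ²ᶜ φ^(−2C) ≥ 1, and with these the two differences
-- 5Q − L φ²ᶜ and U φ²ᶜ − 5Q become sums of visibly nonnegative terms. Everything takes place in
-- ℚ(√5) ⊂ ℝ, whose positive cone is closed under + and · by comparing p² with 5q² for p + q√5.

open import Defs
open import Data.Nat as ℕ using (ℕ; zero; suc; s≤s; z≤n)
import Data.Nat.Properties as ℕP
open import Data.Integer as ℤ using (+_)
import Data.Integer.Properties as ℤP
import Data.Integer.Tactic.RingSolver as ℤSolver
open import Data.Rational as ℚ using (ℚ; 0ℚ; 1ℚ)
import Data.Rational.Properties as ℚP
open import Data.Rational.Unnormalised as ℚᵘ using (mkℚᵘ; *≡*)
import Data.Rational.Unnormalised.Properties as ℚᵘP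
open import Data.Empty using (⊥; ⊥-elim)
open import Data.List using (List; _∷_; [])
open import Data.Product using (_×_; _,_; proj₁; proj₂)
open import Data.Sum using (inj₁; inj₂)
open import Relation.Nullary using (Dec; yes; no; ¬_)
open import Relation.Nullary.Decidable using (True; toWitness; map′; _×-dec_; _⊎-dec_; dec⇒maybe)
open import Relation.Binary.PropositionalEquality
open import Level using (0ℓ)
open import Algebra.Bundles using (CommutativeRing)
open import Algebra.Structures {A = ℚ√5} _≡_ using (IsCommutativeRing)
import Tactic.RingSolver.Core.AlmostCommutativeRing as ACR
open import Tactic.RingSolver using (solve-∀; solve)

-- The ring ℚ(√5)

ℚ-ring : ACR.AlmostCommutativeRing 0ℓ 0ℓ
ℚ-ring = ACR.fromCommutativeRing ℚP.+-*-commutativeRing (λ x → dec⇒maybe (0ℚ ℚP.≟ x))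

five : ℚ
five = ℤ.+ 5 ℚ./ 1

zero√ : ℚ√5
zero√ = ofℚ 0ℚ

≡-components : ∀ {p q r s} → p ≡ r → q ≡ s → (p + q √5) ≡ (r + s √5)
≡-components refl refl = refl

⊕-assoc : ∀ x y z → (x ⊕ y) ⊕ z ≡ x ⊕ (y ⊕ z)
⊕-assoc (p + q √5) (r + s √5) (t + u √5) = ≡-components (ℚP.+-assoc p r t) (ℚP.+-assoc q s u)

⊕-comm : ∀ x y → x ⊕ y ≡ y ⊕ x
⊕-comm (p + q √5) (r + s √5) = ≡-components (ℚP.+-comm p r) (ℚP.+-comm q s)

⊕-identityˡ : ∀ x → zero√ ⊕ x ≡ x
⊕-identityˡ (p + q √5) = ≡-components (ℚP.+-identityˡ p) (ℚP.+-identityˡ q)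

⊕-identityʳ : ∀ x → x ⊕ zero√ ≡ x
⊕-identityʳ (p + q √5) = ≡-components (ℚP.+-identityʳ p) (ℚP.+-identityʳ q)

⊝-inverseˡ : ∀ x → (⊝ x) ⊕ x ≡ zero√
⊝-inverseˡ (p + q √5) = ≡-components (ℚP.+-inverseˡ p) (ℚP.+-inverseˡ q)

⊝-inverseʳ : ∀ x → x ⊕ (⊝ x) ≡ zero√
⊝-inverseʳ (p + q √5) = ≡-components (ℚP.+-inverseʳ p) (ℚP.+-inverseʳ q)

⊗-assoc : ∀ x y z → (x ⊗ y) ⊗ z ≡ x ⊗ (y ⊗ z)
⊗-assoc (p + q √5) (r + s √5) (t + u √5) = ≡-components (re-assoc p q r s t u) (im-assoc p q r s t u)
  where
  re-assoc : ∀ p q r s t u → (p ℚ.* r ℚ.+ five ℚ.* (q ℚ.* s)) ℚ.* t ℚ.+ five ℚ.* ((p ℚ.* s ℚ.+ q ℚ.* r) ℚ.* u)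
                           ≡ p ℚ.* (r ℚ.* t ℚ.+ five ℚ.* (s ℚ.* u)) ℚ.+ five ℚ.* (q ℚ.* (r ℚ.* u ℚ.+ s ℚ.* t))
  re-assoc = solve-∀ ℚ-ring
  im-assoc : ∀ p q r s t u → (p ℚ.* r ℚ.+ five ℚ.* (q ℚ.* s)) ℚ.* u ℚ.+ (p ℚ.* s ℚ.+ q ℚ.* r) ℚ.* t
                           ≡ p ℚ.* (r ℚ.* u ℚ.+ s ℚ.* t) ℚ.+ q ℚ.* (r ℚ.* t ℚ.+ five ℚ.* (s ℚ.* u))
  im-assoc = solve-∀ ℚ-ring

⊗-comm : ∀ x y → x ⊗ y ≡ y ⊗ x
⊗-comm (p + q √5) (r + s √5) = ≡-components (re-comm p q r s) (im-comm p q r s)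
  where
  re-comm : ∀ p q r s → p ℚ.* r ℚ.+ five ℚ.* (q ℚ.* s) ≡ r ℚ.* p ℚ.+ five ℚ.* (s ℚ.* q)
  re-comm = solve-∀ ℚ-ring
  im-comm : ∀ p q r s → p ℚ.* s ℚ.+ q ℚ.* r ≡ r ℚ.* q ℚ.+ s ℚ.* p
  im-comm = solve-∀ ℚ-ring

⊗-identityˡ : ∀ x → one ⊗ x ≡ x
⊗-identityˡ (p + q √5) = ≡-components (re-id p q) (im-id p q)
  where
  re-id : ∀ p q → 1ℚ ℚ.* p ℚ.+ five ℚ.* (0ℚ ℚ.* q) ≡ p
  re-id = solve-∀ ℚ-ring
  im-id : ∀ p q → 1ℚ ℚ.* q ℚ.+ 0ℚ ℚ.* p ≡ q
  im-id = solve-∀ ℚ-ring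

⊗-identityʳ : ∀ x → x ⊗ one ≡ x
⊗-identityʳ x = trans (⊗-comm x one) (⊗-identityˡ x)

⊗-distribˡ-⊕ : ∀ x y z → x ⊗ (y ⊕ z) ≡ x ⊗ y ⊕ x ⊗ z
⊗-distribˡ-⊕ (p + q √5) (r + s √5) (t + u √5) =
  ≡-components (re-distrib p q r s t u) (im-distrib p q r s t u)
  where
  re-distrib : ∀ p q r s t u → p ℚ.* (r ℚ.+ t) ℚ.+ five ℚ.* (q ℚ.* (s ℚ.+ u))
                             ≡ (p ℚ.* r ℚ.+ five ℚ.* (q ℚ.* s)) ℚ.+ (p ℚ.* t ℚ.+ five ℚ.* (q ℚ.* u))
  re-distrib = solve-∀ ℚ-ring
  im-distrib : ∀ p q r s t u → p ℚ.* (s ℚ.+ u) ℚ.+ q ℚ.* (r ℚ.+ t)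
                             ≡ (p ℚ.* s ℚ.+ q ℚ.* r) ℚ.+ (p ℚ.* u ℚ.+ q ℚ.* t)
  im-distrib = solve-∀ ℚ-ring

⊗-distribʳ-⊕ : ∀ x y z → (y ⊕ z) ⊗ x ≡ y ⊗ x ⊕ z ⊗ x
⊗-distribʳ-⊕ x y z = begin
  (y ⊕ z) ⊗ x     ≡⟨ ⊗-comm (y ⊕ z) x ⟩
  x ⊗ (y ⊕ z)     ≡⟨ ⊗-distribˡ-⊕ x y z ⟩
  x ⊗ y ⊕ x ⊗ z   ≡⟨ cong₂ _⊕_ (⊗-comm x y) (⊗-comm x z) ⟩
  y ⊗ x ⊕ z ⊗ x   ∎
  where open ≡-Reasoning

⊕-⊗-isCommutativeRing : IsCommutativeRing _⊕_ _⊗_ ⊝_ zero√ one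
⊕-⊗-isCommutativeRing = record
  { isRing = record
    { +-isAbelianGroup = record
      { isGroup = record
        { isMonoid = record
          { isSemigroup = record
            { isMagma = record { isEquivalence = isEquivalence ; ∙-cong = cong₂ _⊕_ }
            ; assoc = ⊕-assoc }
          ; identity = ⊕-identityˡ , ⊕-identityʳ }
        ; inverse = ⊝-inverseˡ , ⊝-inverseʳ
        ; ⁻¹-cong = cong ⊝_ }
      ; comm = ⊕-comm }
    ; *-cong = cong₂ _⊗_
    ; *-assoc = ⊗-assoc
    ; *-identity = ⊗-identityˡ , ⊗-identityʳ
    ; distrib = ⊗-distribˡ-⊕ , ⊗-distribʳ-⊕ }
  ; *-comm = ⊗-comm }

⊕-⊗-commutativeRing : CommutativeRing 0ℓ 0ℓ
⊕-⊗-commutativeRing = record { isCommutativeRing = ⊕-⊗-isCommutativeRing }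

_≟_ : (x y : ℚ√5) → Dec (x ≡ y)
(p + q √5) ≟ (r + s √5) =
  map′ (λ (p≡r , q≡s) → ≡-components p≡r q≡s) (λ { refl → refl , refl }) ((p ℚP.≟ r) ×-dec (q ℚP.≟ s))

ℚ√5-ring : ACR.AlmostCommutativeRing 0ℓ 0ℓ
ℚ√5-ring = ACR.fromCommutativeRing ⊕-⊗-commutativeRing (λ x → dec⇒maybe (zero√ ≟ x))

/1-toℚᵘ : ∀ i → ℚ.toℚᵘ (i ℚ./ 1) ℚᵘ.≃ mkℚᵘ i 0
/1-toℚᵘ i = ℚP.toℚᵘ-fromℚᵘ (mkℚᵘ i 0)

/1-homo-+ : ∀ i j → (i ℤ.+ j) ℚ./ 1 ≡ i ℚ./ 1 ℚ.+ j ℚ./ 1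
/1-homo-+ i j = ℚP.toℚᵘ-injective (begin
  ℚ.toℚᵘ ((i ℤ.+ j) ℚ./ 1)                  ≈⟨ /1-toℚᵘ (i ℤ.+ j) ⟩
  mkℚᵘ (i ℤ.+ j) 0                          ≈⟨ *≡* (ℤ-identity i j) ⟩
  mkℚᵘ i 0 ℚᵘ.+ mkℚᵘ j 0                    ≈⟨ ℚᵘP.+-cong (/1-toℚᵘ i) (/1-toℚᵘ j) ⟨
  ℚ.toℚᵘ (i ℚ./ 1) ℚᵘ.+ ℚ.toℚᵘ (j ℚ./ 1)    ≈⟨ ℚP.toℚᵘ-homo-+ (i ℚ./ 1) (j ℚ./ 1) ⟨
  ℚ.toℚᵘ (i ℚ./ 1 ℚ.+ j ℚ./ 1)              ∎)
  where
  open ℚᵘP.≃-Reasoning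
  ℤ-identity : ∀ i j → (i ℤ.+ j) ℤ.* + 1 ≡ (i ℤ.* + 1 ℤ.+ j ℤ.* + 1) ℤ.* + 1
  ℤ-identity = ℤSolver.solve-∀

/1-homo-* : ∀ i j → (i ℤ.* j) ℚ./ 1 ≡ (i ℚ./ 1) ℚ.* (j ℚ./ 1)
/1-homo-* i j = ℚP.toℚᵘ-injective (begin
  ℚ.toℚᵘ ((i ℤ.* j) ℚ./ 1)                  ≈⟨ /1-toℚᵘ (i ℤ.* j) ⟩
  mkℚᵘ (i ℤ.* j) 0                          ≈⟨ ℚᵘP.*-cong (/1-toℚᵘ i) (/1-toℚᵘ j) ⟨
  ℚ.toℚᵘ (i ℚ./ 1) ℚᵘ.* ℚ.toℚᵘ (j ℚ./ 1)    ≈⟨ ℚP.toℚᵘ-homo-* (i ℚ./ 1) (j ℚ./ 1) ⟨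
  ℚ.toℚᵘ ((i ℚ./ 1) ℚ.* (j ℚ./ 1))              ∎)
  where open ℚᵘP.≃-Reasoning

/1-homo-neg : ∀ i → (ℤ.- i) ℚ./ 1 ≡ ℚ.- (i ℚ./ 1)
/1-homo-neg i = ℚP.toℚᵘ-injective (begin
  ℚ.toℚᵘ ((ℤ.- i) ℚ./ 1)    ≈⟨ /1-toℚᵘ (ℤ.- i) ⟩
  mkℚᵘ (ℤ.- i) 0            ≈⟨ ℚᵘP.-‿cong (/1-toℚᵘ i) ⟨
  ℚᵘ.- ℚ.toℚᵘ (i ℚ./ 1)     ≈⟨ ℚP.toℚᵘ-homo‿- (i ℚ./ 1) ⟨
  ℚ.toℚᵘ (ℚ.- (i ℚ./ 1))    ∎)
  where open ℚᵘP.≃-Reasoning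

ofℚ-homo-* : ∀ p q → ofℚ (p ℚ.* q) ≡ ofℚ p ⊗ ofℚ q
ofℚ-homo-* p q = ≡-components (re-homo p q) (im-homo p q)
  where
  re-homo : ∀ p q → p ℚ.* q ≡ p ℚ.* q ℚ.+ five ℚ.* (0ℚ ℚ.* 0ℚ)
  re-homo = solve-∀ ℚ-ring
  im-homo : ∀ p q → 0ℚ ≡ p ℚ.* 0ℚ ℚ.+ 0ℚ ℚ.* q
  im-homo = solve-∀ ℚ-ring

ofℤ-homo-+ : ∀ i j → ofℤ (i ℤ.+ j) ≡ ofℤ i ⊕ ofℤ j
ofℤ-homo-+ i j = cong ofℚ (/1-homo-+ i j)

ofℤ-homo-* : ∀ i j → ofℤ (i ℤ.* j) ≡ ofℤ i ⊗ ofℤ j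
ofℤ-homo-* i j = trans (cong ofℚ (/1-homo-* i j)) (ofℚ-homo-* (i ℚ./ 1) (j ℚ./ 1))

ofℤ-homo-- : ∀ i j → ofℤ (i ℤ.- j) ≡ ofℤ i ⊖ ofℤ j
ofℤ-homo-- i j = cong ofℚ (trans (/1-homo-+ i (ℤ.- j)) (cong (i ℚ./ 1 ℚ.+_) (/1-homo-neg j)))

ofℕ : ℕ → ℚ√5
ofℕ n = ofℤ (+ n)

ofℕ-homo-+ : ∀ m n → ofℕ (m ℕ.+ n) ≡ ofℕ m ⊕ ofℕ n
ofℕ-homo-+ m n = trans (cong ofℤ (ℤP.pos-+ m n)) (ofℤ-homo-+ (+ m) (+ n))

ofℕ-homo-* : ∀ m n → ofℕ (m ℕ.* n) ≡ ofℕ m ⊗ ofℕ n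
ofℕ-homo-* m n = trans (cong ofℤ (ℤP.pos-* m n)) (ofℤ-homo-* (+ m) (+ n))

two three six nine fifth six/5 36/25 12/5 : ℚ√5
two = ofℤ (+ 2)
three = ofℤ (+ 3)
six = ofℤ (+ 6)
nine = ofℤ (+ 9)
fifth = ofℚ (+ 1 ℚ./ 5)
six/5 = ofℚ (+ 6 ℚ./ 5)
36/25 = ofℚ (+ 36 ℚ./ 25)
12/5 = ofℚ (+ 12 ℚ./ 5)


module Cone where

  open import Data.Rational using (_+_; _*_; _-_; -_; _≤_; _<_)

  0≤-+ : ∀ {x y} → 0ℚ ≤ x → 0ℚ ≤ y → 0ℚ ≤ x + y
  0≤-+ = ℚP.+-mono-≤

  0≤-* : ∀ {x y} → 0ℚ ≤ x → 0ℚ ≤ y → 0ℚ ≤ x * y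
  0≤-* {x} {y} 0≤x 0≤y =
    ℚP.nonNegative⁻¹ _ {{ℚP.nonNeg*nonNeg⇒nonNeg x {{ℚ.nonNegative 0≤x}} y {{ℚ.nonNegative 0≤y}}}}

  0<-* : ∀ {x y} → 0ℚ < x → 0ℚ < y → 0ℚ < x * y
  0<-* {x} {y} 0<x 0<y = ℚP.positive⁻¹ _ {{ℚP.pos*pos⇒pos x {{ℚ.positive 0<x}} y {{ℚ.positive 0<y}}}}

  0≤-square : ∀ x → 0ℚ ≤ x * x
  0≤-square x with ℚP.≤-total 0ℚ x
  ... | inj₁ 0≤x = 0≤-* 0≤x 0≤x
  ... | inj₂ x≤0 = ℚP.nonNegative⁻¹ _ {{ℚP.nonPos*nonPos⇒nonPos x {{ℚ.nonPositive x≤0}} x {{ℚ.nonPositive x≤0}}}}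

  ≤⇒0≤- : ∀ {x y} → x ≤ y → 0ℚ ≤ y - x
  ≤⇒0≤- {x} {y} x≤y = subst (_≤ y - x) (ℚP.+-inverseʳ x) (ℚP.+-monoˡ-≤ (- x) x≤y)

  0≤-⇒≤ : ∀ {x y} → 0ℚ ≤ y - x → x ≤ y
  0≤-⇒≤ {x} {y} 0≤y-x = subst₂ _≤_ (ℚP.+-identityˡ x) (difference-cancel x y) (ℚP.+-monoˡ-≤ x 0≤y-x)
    where
    difference-cancel : ∀ x y → (y - x) + x ≡ y
    difference-cancel = solve-∀ ℚ-ring

  0≤⇒¬0<- : ∀ {x} → 0ℚ ≤ x → ¬ 0ℚ < - x
  0≤⇒¬0<- {x} 0≤x 0<-x = ℚP.<-irrefl refl (subst (0ℚ <_) (ℚP.+-inverseʳ x) (ℚP.+-mono-≤-< 0≤x 0<-x))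

  0≤-cancel : ∀ {c x} → 0ℚ < c → 0ℚ ≤ c * x → 0ℚ ≤ x
  0≤-cancel {c} {x} 0<c 0≤cx with 0ℚ ℚP.≤? x
  ... | yes 0≤x = 0≤x
  ... | no 0≰x = ⊥-elim (0≤⇒¬0<- 0≤cx
    (subst (0ℚ <_) (sym (ℚP.neg-distribʳ-* c x)) (0<-* 0<c (ℚP.neg-antimono-< (ℚP.≰⇒> 0≰x)))))

  squares-≤⇒∣∣≤ : ∀ {u v} → 0ℚ ≤ v → 0ℚ ≤ v * v - u * u → 0ℚ ≤ v - u × 0ℚ ≤ v + u
  squares-≤⇒∣∣≤ {u} {v} 0≤v 0≤v²-u² =
    difference-nonNeg u 0≤v²-u² ,
    subst (0ℚ ≤_) (v--u≡v+u u v) (difference-nonNeg (- u) (subst (λ w → 0ℚ ≤ v * v - w) (u²≡[-u]² u) 0≤v²-u²))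
    where
    v--u≡v+u : ∀ u v → v - - u ≡ v + u
    v--u≡v+u = solve-∀ ℚ-ring
    u²≡[-u]² : ∀ u → u * u ≡ - u * - u
    u²≡[-u]² = solve-∀ ℚ-ring
    factor : ∀ u v → - (v - u) * (- (v - u) + (v + v)) ≡ - (v * v - u * u)
    factor = solve-∀ ℚ-ring
    difference-nonNeg : ∀ u → 0ℚ ≤ v * v - u * u → 0ℚ ≤ v - u
    difference-nonNeg u 0≤v²-u² with 0ℚ ℚP.≤? v - u
    ... | yes 0≤v-u = 0≤v-u
    ... | no 0≰v-u = ⊥-elim (0≤⇒¬0<- 0≤v²-u²
      (subst (0ℚ <_) (factor u v) (0<-* 0<u-v (ℚP.+-mono-<-≤ 0<u-v (0≤-+ 0≤v 0≤v)))))
      where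
      0<u-v : 0ℚ < - (v - u)
      0<u-v = ℚP.neg-antimono-< (ℚP.≰⇒> 0≰v-u)

  norm : ℚ → ℚ → ℚ
  norm p q = p * p - five * (q * q)

  -- p + q√5 ≥ 0 iff whichever of p and q√5 is larger in absolute value (compared through the sign of
  -- the norm) has a nonnegative coefficient.
  data NonNegParts (p q : ℚ) : Set where
    rational-dominant : 0ℚ ≤ p → 0ℚ ≤ norm p q → NonNegParts p q
    surd-dominant     : 0ℚ ≤ q → 0ℚ ≤ - norm p q → NonNegParts p q

  coefficients-nonNeg⇒parts : ∀ {p q} → 0ℚ ≤ p → 0ℚ ≤ q → NonNegParts p q
  coefficients-nonNeg⇒parts {p} {q} 0≤p 0≤q with 0ℚ ℚP.≤? norm p q
  ... | yes 0≤N = rational-dominant 0≤p 0≤N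
  ... | no 0≰N = surd-dominant 0≤q (ℚP.<⇒≤ (ℚP.neg-antimono-< (ℚP.≰⇒> 0≰N)))

  nonNeg⇒parts : ∀ {p q} → NonNeg (p + q √5) → NonNegParts p q
  nonNeg⇒parts (inj₁ (0≤p , 0≤q)) = coefficients-nonNeg⇒parts 0≤p 0≤q
  nonNeg⇒parts (inj₂ (inj₁ (0≤p , _ , 5q²≤p²))) = rational-dominant 0≤p (≤⇒0≤- 5q²≤p²)
  nonNeg⇒parts {p} {q} (inj₂ (inj₂ (_ , 0<q , p²≤5q²))) =
    surd-dominant (ℚP.<⇒≤ 0<q) (subst (0ℚ ≤_) (swap-difference (five * (q * q)) (p * p)) (≤⇒0≤- p²≤5q²))
    where
    swap-difference : ∀ a b → a - b ≡ - (b - a)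
    swap-difference = solve-∀ ℚ-ring

  parts⇒nonNeg : ∀ {p q} → NonNegParts p q → NonNeg (p + q √5)
  parts⇒nonNeg {p} {q} (rational-dominant 0≤p 0≤N) with 0ℚ ℚP.≤? q
  ... | yes 0≤q = inj₁ (0≤p , 0≤q)
  ... | no 0≰q = inj₂ (inj₁ (0≤p , ℚP.≰⇒> 0≰q , 0≤-⇒≤ 0≤N))
  parts⇒nonNeg {p} {q} (surd-dominant 0≤q 0≤-N) with 0ℚ ℚP.≤? p | 0ℚ ℚP.<? q
  ... | yes 0≤p | _ = inj₁ (0≤p , 0≤q)
  ... | no 0≰p | yes 0<q = inj₂ (inj₂ (ℚP.≰⇒> 0≰p , 0<q , 0≤-⇒≤ (subst (0ℚ ≤_) (negated-norm p q) 0≤-N)))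
    where
    negated-norm : ∀ p q → - (p * p - five * (q * q)) ≡ five * (q * q) - p * p
    negated-norm = solve-∀ ℚ-ring
  ... | no 0≰p | no 0≮q = ⊥-elim (0≤⇒¬0<- 0≤-N (subst (0ℚ <_) (p²≡--N q≡0) (0<-* -p>0 -p>0)))
    where
    q≡0 : q ≡ 0ℚ
    q≡0 = ℚP.≤-antisym (ℚP.≮⇒≥ 0≮q) 0≤q
    -p>0 : 0ℚ < - p
    -p>0 = ℚP.neg-antimono-< (ℚP.≰⇒> 0≰p)
    p²≡--N : q ≡ 0ℚ → - p * - p ≡ - - norm p q
    p²≡--N refl = identity p
      where
      identity : ∀ p → - p * - p ≡ - - (p * p - five * (0ℚ * 0ℚ))
      identity = solve-∀ ℚ-ring

  rational-rational-bound : ∀ {p q r s} → 0ℚ ≤ p → 0ℚ ≤ norm p q → 0ℚ ≤ r → 0ℚ ≤ norm r s →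
                            0ℚ ≤ p * r - five * (q * s) × 0ℚ ≤ p * r + five * (q * s)
  rational-rational-bound {p} {q} {r} {s} 0≤p 0≤Nx 0≤r 0≤Ny = squares-≤⇒∣∣≤ (0≤-* 0≤p 0≤r)
    (subst (0ℚ ≤_) (identity p q r s)
      (0≤-+ (0≤-* 0≤Nx (0≤-square r)) (0≤-* (0≤-* (ℚP.nonNegative⁻¹ five) (0≤-square q)) 0≤Ny)))
    where
    identity : ∀ p q r s → (p * p - five * (q * q)) * (r * r) + five * (q * q) * (r * r - five * (s * s))
                         ≡ p * r * (p * r) - five * (q * s) * (five * (q * s))
    identity = solve-∀ ℚ-ring

  surd-surd-bound : ∀ {p q r s} → 0ℚ ≤ q → 0ℚ ≤ - norm p q → 0ℚ ≤ s → 0ℚ ≤ - norm r s →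
                    0ℚ ≤ five * (q * s) - p * r × 0ℚ ≤ five * (q * s) + p * r
  surd-surd-bound {p} {q} {r} {s} 0≤q 0≤-Nx 0≤s 0≤-Ny = squares-≤⇒∣∣≤ (0≤-* (ℚP.nonNegative⁻¹ five) (0≤-* 0≤q 0≤s))
    (subst (0ℚ ≤_) (identity p q r s)
      (0≤-+ (0≤-* 0≤-Nx (0≤-* (ℚP.nonNegative⁻¹ five) (0≤-square s))) (0≤-* (0≤-square p) 0≤-Ny)))
    where
    identity : ∀ p q r s → - (p * p - five * (q * q)) * (five * (s * s)) + p * p * - (r * r - five * (s * s))
                         ≡ five * (q * s) * (five * (q * s)) - p * r * (p * r)
    identity = solve-∀ ℚ-ring

  rational-surd-bound : ∀ {p q r s} → 0ℚ ≤ p → 0ℚ ≤ norm p q → 0ℚ ≤ s → 0ℚ ≤ - norm r s →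
                        0ℚ ≤ p * s - q * r × 0ℚ ≤ p * s + q * r
  rational-surd-bound {p} {q} {r} {s} 0≤p 0≤Nx 0≤s 0≤-Ny = squares-≤⇒∣∣≤ (0≤-* 0≤p 0≤s)
    (subst (0ℚ ≤_) (identity p q r s) (0≤-+ (0≤-* (0≤-square s) 0≤Nx) (0≤-* (0≤-square q) 0≤-Ny)))
    where
    identity : ∀ p q r s → s * s * (p * p - five * (q * q)) + q * q * - (r * r - five * (s * s))
                         ≡ p * s * (p * s) - q * r * (q * r)
    identity = solve-∀ ℚ-ring

  parts-* : ∀ {p q r s} → NonNegParts p q → NonNegParts r s → NonNegParts (p * r + five * (q * s)) (p * s + q * r)
  parts-* {p} {q} {r} {s} (rational-dominant 0≤p 0≤Nx) (rational-dominant 0≤r 0≤Ny) =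
    rational-dominant (proj₂ (rational-rational-bound {p} {q} {r} {s} 0≤p 0≤Nx 0≤r 0≤Ny))
                      (subst (0ℚ ≤_) (identity p q r s) (0≤-* 0≤Nx 0≤Ny))
    where
    identity : ∀ p q r s → (p * p - five * (q * q)) * (r * r - five * (s * s))
                         ≡ (p * r + five * (q * s)) * (p * r + five * (q * s)) - five * ((p * s + q * r) * (p * s + q * r))
    identity = solve-∀ ℚ-ring
  parts-* {p} {q} {r} {s} (surd-dominant 0≤q 0≤-Nx) (surd-dominant 0≤s 0≤-Ny) =
    rational-dominant (subst (0ℚ ≤_) (ℚP.+-comm (five * (q * s)) (p * r))
                        (proj₂ (surd-surd-bound {p} {q} {r} {s} 0≤q 0≤-Nx 0≤s 0≤-Ny)))
                      (subst (0ℚ ≤_) (identity p q r s) (0≤-* 0≤-Nx 0≤-Ny))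
    where
    identity : ∀ p q r s → - (p * p - five * (q * q)) * - (r * r - five * (s * s))
                         ≡ (p * r + five * (q * s)) * (p * r + five * (q * s)) - five * ((p * s + q * r) * (p * s + q * r))
    identity = solve-∀ ℚ-ring
  parts-* {p} {q} {r} {s} (rational-dominant 0≤p 0≤Nx) (surd-dominant 0≤s 0≤-Ny) =
    surd-dominant (proj₂ (rational-surd-bound {p} {q} {r} {s} 0≤p 0≤Nx 0≤s 0≤-Ny))
                  (subst (0ℚ ≤_) (identity p q r s) (0≤-* 0≤Nx 0≤-Ny))
    where
    identity : ∀ p q r s → (p * p - five * (q * q)) * - (r * r - five * (s * s))
                         ≡ - ((p * r + five * (q * s)) * (p * r + five * (q * s)) - five * ((p * s + q * r) * (p * s + q * r)))
    identity = solve-∀ ℚ-ring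
  parts-* {p} {q} {r} {s} (surd-dominant 0≤q 0≤-Nx) (rational-dominant 0≤r 0≤Ny) =
    surd-dominant (subst (0ℚ ≤_) (swap p q r s) (proj₂ (rational-surd-bound {r} {s} {p} {q} 0≤r 0≤Ny 0≤q 0≤-Nx)))
                  (subst (0ℚ ≤_) (identity p q r s) (0≤-* 0≤-Nx 0≤Ny))
    where
    swap : ∀ p q r s → r * q + s * p ≡ p * s + q * r
    swap = solve-∀ ℚ-ring
    identity : ∀ p q r s → - (p * p - five * (q * q)) * (r * r - five * (s * s))
                         ≡ - ((p * r + five * (q * s)) * (p * r + five * (q * s)) - five * ((p * s + q * r) * (p * s + q * r)))
    identity = solve-∀ ℚ-ring

  cancel-summand : ∀ a b → - (a + b) + b ≡ - a
  cancel-summand = solve-∀ ℚ-ring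

  -- The sum of a rational-dominant p + q√5 and a surd-dominant r + s√5, by the signs of p + r and q + s.
  -- In the two mixed cases a positive factor q² (resp. r²) turns the norm into a sum of nonnegative terms.
  rational-surd-+-norm : ∀ {p q r s} → 0ℚ ≤ p → 0ℚ ≤ norm p q → 0ℚ ≤ s → 0ℚ ≤ - norm r s →
                         q + s < 0ℚ → 0ℚ ≤ norm (p + r) (q + s)
  rational-surd-+-norm {p} {q} {r} {s} 0≤p 0≤Nx 0≤s 0≤-Ny q+s<0 = 0≤-cancel (0<-* 0<-q 0<-q)
    (subst (0ℚ ≤_) (identity p q r s) (0≤-+ (0≤-+ (0≤-* (0≤-square (q + s)) 0≤Nx)
                                                   (0≤-* (0≤-* (0≤-+ 0≤p 0≤p) (ℚP.<⇒≤ 0<-[q+s])) 0≤ps-qr))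
                                             (0≤-square (p * s - q * r))))
    where
    0<-[q+s] : 0ℚ < - (q + s)
    0<-[q+s] = ℚP.neg-antimono-< q+s<0
    0<-q : 0ℚ < - q
    0<-q = subst (0ℚ <_) (cancel-summand q s) (ℚP.+-mono-<-≤ 0<-[q+s] 0≤s)
    0≤ps-qr : 0ℚ ≤ p * s - q * r
    0≤ps-qr = proj₁ (rational-surd-bound {p} {q} {r} {s} 0≤p 0≤Nx 0≤s 0≤-Ny)
    identity : ∀ p q r s → (q + s) * (q + s) * (p * p - five * (q * q)) + (p + p) * - (q + s) * (p * s - q * r)
                           + (p * s - q * r) * (p * s - q * r)
                         ≡ - q * - q * ((p + r) * (p + r) - five * ((q + s) * (q + s)))
    identity = solve-∀ ℚ-ring

  rational-surd-+-negated-norm : ∀ {p q r s} → 0ℚ ≤ p → 0ℚ ≤ norm p q → 0ℚ ≤ s → 0ℚ ≤ - norm r s →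
                                 p + r < 0ℚ → 0ℚ ≤ - norm (p + r) (q + s)
  rational-surd-+-negated-norm {p} {q} {r} {s} 0≤p 0≤Nx 0≤s 0≤-Ny p+r<0 = 0≤-cancel (0<-* 0<-r 0<-r)
    (subst (0ℚ ≤_) (identity p q r s) (0≤-+ (0≤-+ (0≤-* (0≤-square (p + r)) 0≤-Ny)
                                                   (0≤-* (0≤-* (0≤-* (ℚP.nonNegative⁻¹ (five + five)) 0≤s)
                                                               (ℚP.<⇒≤ 0<-[p+r]))
                                                         0≤ps-qr))
                                             (0≤-* (ℚP.nonNegative⁻¹ five) (0≤-square (p * s - q * r)))))
    where
    0<-[p+r] : 0ℚ < - (p + r)
    0<-[p+r] = ℚP.neg-antimono-< p+r<0
    0<-r : 0ℚ < - r
    0<-r = subst (0ℚ <_) (trans (cong (λ w → - w + p) (ℚP.+-comm p r)) (cancel-summand r p)) (ℚP.+-mono-<-≤ 0<-[p+r] 0≤p)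
    0≤ps-qr : 0ℚ ≤ p * s - q * r
    0≤ps-qr = proj₁ (rational-surd-bound {p} {q} {r} {s} 0≤p 0≤Nx 0≤s 0≤-Ny)
    identity : ∀ p q r s → (p + r) * (p + r) * - (r * r - five * (s * s)) + (five + five) * s * - (p + r) * (p * s - q * r)
                           + five * ((p * s - q * r) * (p * s - q * r))
                         ≡ - r * - r * - ((p + r) * (p + r) - five * ((q + s) * (q + s)))
    identity = solve-∀ ℚ-ring

  rational-surd-+-not-both-negative : ∀ {p q r s} → 0ℚ ≤ p → 0ℚ ≤ norm p q → 0ℚ ≤ s → 0ℚ ≤ - norm r s →
                                      p + r < 0ℚ → q + s < 0ℚ → ⊥
  rational-surd-+-not-both-negative {p} {q} {r} {s} 0≤p 0≤Nx 0≤s 0≤-Ny p+r<0 q+s<0 =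
    0≤⇒¬0<- (0≤-+ 0≤Nx 0≤-Ny) (subst (0ℚ <_) (identity p q r s)
      (ℚP.+-mono-< (0<-* 0<-[p+r] (ℚP.+-mono-<-≤ 0<-[p+r] (0≤-+ 0≤p 0≤p)))
                   (ℚP.*-monoʳ-<-pos five (0<-* 0<-[q+s] (ℚP.+-mono-<-≤ 0<-[q+s] (0≤-+ 0≤s 0≤s))))))
    where
    0<-[p+r] : 0ℚ < - (p + r)
    0<-[p+r] = ℚP.neg-antimono-< p+r<0
    0<-[q+s] : 0ℚ < - (q + s)
    0<-[q+s] = ℚP.neg-antimono-< q+s<0
    identity : ∀ p q r s → - (p + r) * (- (p + r) + (p + p)) + five * (- (q + s) * (- (q + s) + (s + s)))
                         ≡ - ((p * p - five * (q * q)) + - (r * r - five * (s * s)))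
    identity = solve-∀ ℚ-ring

  rational-surd-+ : ∀ {p q r s} → 0ℚ ≤ p → 0ℚ ≤ norm p q → 0ℚ ≤ s → 0ℚ ≤ - norm r s →
                    NonNegParts (p + r) (q + s)
  rational-surd-+ {p} {q} {r} {s} 0≤p 0≤Nx 0≤s 0≤-Ny with 0ℚ ℚP.≤? p + r | 0ℚ ℚP.≤? q + s
  ... | yes 0≤p+r | yes 0≤q+s = coefficients-nonNeg⇒parts 0≤p+r 0≤q+s
  ... | yes 0≤p+r | no 0≰q+s =
    rational-dominant 0≤p+r (rational-surd-+-norm {p} {q} {r} {s} 0≤p 0≤Nx 0≤s 0≤-Ny (ℚP.≰⇒> 0≰q+s))
  ... | no 0≰p+r | yes 0≤q+s =
    surd-dominant 0≤q+s (rational-surd-+-negated-norm {p} {q} {r} {s} 0≤p 0≤Nx 0≤s 0≤-Ny (ℚP.≰⇒> 0≰p+r))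
  ... | no 0≰p+r | no 0≰q+s =
    ⊥-elim (rational-surd-+-not-both-negative {p} {q} {r} {s} 0≤p 0≤Nx 0≤s 0≤-Ny (ℚP.≰⇒> 0≰p+r) (ℚP.≰⇒> 0≰q+s))

  parts-+ : ∀ {p q r s} → NonNegParts p q → NonNegParts r s → NonNegParts (p + r) (q + s)
  parts-+ {p} {q} {r} {s} (rational-dominant 0≤p 0≤Nx) (rational-dominant 0≤r 0≤Ny) =
    rational-dominant (0≤-+ 0≤p 0≤r)
                      (subst (0ℚ ≤_) (identity p q r s) (0≤-+ (0≤-+ 0≤Nx 0≤Ny) (0≤-+ 0≤pr-5qs 0≤pr-5qs)))
    where
    0≤pr-5qs : 0ℚ ≤ p * r - five * (q * s)
    0≤pr-5qs = proj₁ (rational-rational-bound {p} {q} {r} {s} 0≤p 0≤Nx 0≤r 0≤Ny)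
    identity : ∀ p q r s → (p * p - five * (q * q)) + (r * r - five * (s * s))
                           + ((p * r - five * (q * s)) + (p * r - five * (q * s)))
                         ≡ (p + r) * (p + r) - five * ((q + s) * (q + s))
    identity = solve-∀ ℚ-ring
  parts-+ {p} {q} {r} {s} (surd-dominant 0≤q 0≤-Nx) (surd-dominant 0≤s 0≤-Ny) =
    surd-dominant (0≤-+ 0≤q 0≤s)
                  (subst (0ℚ ≤_) (identity p q r s) (0≤-+ (0≤-+ 0≤-Nx 0≤-Ny) (0≤-+ 0≤5qs-pr 0≤5qs-pr)))
    where
    0≤5qs-pr : 0ℚ ≤ five * (q * s) - p * r
    0≤5qs-pr = proj₁ (surd-surd-bound {p} {q} {r} {s} 0≤q 0≤-Nx 0≤s 0≤-Ny)
    identity : ∀ p q r s → - (p * p - five * (q * q)) + - (r * r - five * (s * s))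
                           + ((five * (q * s) - p * r) + (five * (q * s) - p * r))
                         ≡ - ((p + r) * (p + r) - five * ((q + s) * (q + s)))
    identity = solve-∀ ℚ-ring
  parts-+ {p} {q} {r} {s} (rational-dominant 0≤p 0≤Nx) (surd-dominant 0≤s 0≤-Ny) =
    rational-surd-+ {p} {q} {r} {s} 0≤p 0≤Nx 0≤s 0≤-Ny
  parts-+ {p} {q} {r} {s} (surd-dominant 0≤q 0≤-Nx) (rational-dominant 0≤r 0≤Ny) =
    subst₂ NonNegParts (ℚP.+-comm r p) (ℚP.+-comm s q) (rational-surd-+ {r} {s} {p} {q} 0≤r 0≤Ny 0≤q 0≤-Nx)

  nonNeg-⊕ : ∀ x y → NonNeg x → NonNeg y → NonNeg (x ⊕ y)
  nonNeg-⊕ (p + q √5) (r + s √5) 0≤x 0≤y = parts⇒nonNeg (parts-+ (nonNeg⇒parts 0≤x) (nonNeg⇒parts 0≤y))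

  nonNeg-⊗ : ∀ x y → NonNeg x → NonNeg y → NonNeg (x ⊗ y)
  nonNeg-⊗ (p + q √5) (r + s √5) 0≤x 0≤y = parts⇒nonNeg (parts-* (nonNeg⇒parts 0≤x) (nonNeg⇒parts 0≤y))

  nonNeg-square : ∀ x → NonNeg (x ⊗ x)
  nonNeg-square (p + q √5) = parts⇒nonNeg (rational-dominant
    (0≤-+ (0≤-square p) (0≤-* (ℚP.nonNegative⁻¹ five) (0≤-square q)))
    (subst (0ℚ ≤_) (identity p q) (0≤-square (p * p - five * (q * q)))))
    where
    identity : ∀ p q → (p * p - five * (q * q)) * (p * p - five * (q * q))
                     ≡ (p * p + five * (q * q)) * (p * p + five * (q * q)) - five * ((p * q + q * p) * (p * q + q * p))
    identity = solve-∀ ℚ-ring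

open Cone using (nonNeg-⊕; nonNeg-⊗; nonNeg-square)

-- The order of ℚ(√5) ⊂ ℝ

-- x ≼ y is x ≤√ y wrapped in a record: _≤√_ computes, so Agda cannot infer x and y from it.
infix 4 _≼_
record _≼_ (x y : ℚ√5) : Set where
  constructor ≤√⇒≼
  field ≼⇒≤√ : x ≤√ y
open _≼_ public

nonNeg⇒0≼ : ∀ {x} → NonNeg x → zero√ ≼ x
nonNeg⇒0≼ {x} 0≼x = ≤√⇒≼ (subst NonNeg (identity x) 0≼x)
  where
  identity : ∀ x → x ≡ x ⊖ zero√
  identity = solve-∀ ℚ√5-ring

0≼⇒nonNeg : ∀ {x} → zero√ ≼ x → NonNeg x
0≼⇒nonNeg {x} (≤√⇒≼ 0≼x) = subst NonNeg (identity x) 0≼x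
  where
  identity : ∀ x → x ⊖ zero√ ≡ x
  identity = solve-∀ ℚ√5-ring

0≼⇒≼ : ∀ {x y} → zero√ ≼ y ⊖ x → x ≼ y
0≼⇒≼ 0≼y-x = ≤√⇒≼ (0≼⇒nonNeg 0≼y-x)

≼⇒0≼ : ∀ {x y} → x ≼ y → zero√ ≼ y ⊖ x
≼⇒0≼ (≤√⇒≼ x≼y) = nonNeg⇒0≼ x≼y

0≼-⊕ : ∀ {x y} → zero√ ≼ x → zero√ ≼ y → zero√ ≼ x ⊕ y
0≼-⊕ {x} {y} 0≼x 0≼y = nonNeg⇒0≼ (nonNeg-⊕ x y (0≼⇒nonNeg 0≼x) (0≼⇒nonNeg 0≼y))

0≼-⊗ : ∀ {x y} → zero√ ≼ x → zero√ ≼ y → zero√ ≼ x ⊗ y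
0≼-⊗ {x} {y} 0≼x 0≼y = nonNeg⇒0≼ (nonNeg-⊗ x y (0≼⇒nonNeg 0≼x) (0≼⇒nonNeg 0≼y))

0≼-square : ∀ x → zero√ ≼ x ⊗ x
0≼-square x = nonNeg⇒0≼ (nonNeg-square x)

≼-trans : ∀ {x y z} → x ≼ y → y ≼ z → x ≼ z
≼-trans {x} {y} {z} x≼y y≼z = 0≼⇒≼ (subst (zero√ ≼_) (identity x y z) (0≼-⊕ (≼⇒0≼ y≼z) (≼⇒0≼ x≼y)))
  where
  identity : ∀ x y z → (z ⊖ y) ⊕ (y ⊖ x) ≡ z ⊖ x
  identity = solve-∀ ℚ√5-ring

≼-refl : ∀ {x} → x ≼ x
≼-refl {x} = ≤√⇒≼ (subst NonNeg (sym (⊝-inverseʳ x)) (inj₁ (ℚP.≤-refl , ℚP.≤-refl)))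

*-monoˡ-≼ : ∀ {z x y} → zero√ ≼ z → x ≼ y → z ⊗ x ≼ z ⊗ y
*-monoˡ-≼ {z} {x} {y} 0≼z x≼y = 0≼⇒≼ (subst (zero√ ≼_) (identity z x y) (0≼-⊗ 0≼z (≼⇒0≼ x≼y)))
  where
  identity : ∀ z x y → z ⊗ (y ⊖ x) ≡ z ⊗ y ⊖ z ⊗ x
  identity = solve-∀ ℚ√5-ring

*-mono-≼ : ∀ {x y u v} → zero√ ≼ x → zero√ ≼ u → x ≼ y → u ≼ v → x ⊗ u ≼ y ⊗ v
*-mono-≼ {x} {y} {u} {v} 0≼x 0≼u x≼y u≼v = 0≼⇒≼ (subst (zero√ ≼_) (identity x y u v)
  (0≼-⊕ (0≼-⊗ (≼-trans 0≼x x≼y) (≼⇒0≼ u≼v)) (0≼-⊗ 0≼u (≼⇒0≼ x≼y))))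
  where
  identity : ∀ x y u v → y ⊗ (v ⊖ u) ⊕ u ⊗ (y ⊖ x) ≡ y ⊗ v ⊖ x ⊗ u
  identity = solve-∀ ℚ√5-ring

nonNeg? : ∀ x → Dec (NonNeg x)
nonNeg? (p + q √5) =
      (0ℚ ℚP.≤? p ×-dec 0ℚ ℚP.≤? q)
  ⊎-dec (0ℚ ℚP.≤? p ×-dec q ℚP.<? 0ℚ ×-dec five ℚ.* (q ℚ.* q) ℚP.≤? p ℚ.* p)
  ⊎-dec (p ℚP.<? 0ℚ ×-dec 0ℚ ℚP.<? q ×-dec p ℚ.* p ℚP.≤? five ℚ.* (q ℚ.* q))

_≼?_ : ∀ x y → Dec (x ≼ y)
x ≼? y = map′ ≤√⇒≼ ≼⇒≤√ (nonNeg? (y ⊖ x))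

≼-decide : ∀ {x y} {x≼y : True (x ≼? y)} → x ≼ y
≼-decide {x≼y = x≼y} = toWitness x≼y

module ≼-Reasoning where
  open import Relation.Binary.Reasoning.Base.Single _≼_ ≼-refl ≼-trans public
  open import Relation.Binary.Reasoning.Syntax using (module ≤-syntax)
  open ≤-syntax _IsRelatedTo_ _IsRelatedTo_ ∼-go public

-- Powers of φ and Binet's formula

√5 ψ : ℚ√5
√5 = 0ℚ + 1ℚ √5
ψ = ⊝ φ⁻¹

^-+ : ∀ x m n → x ^ (m ℕ.+ n) ≡ x ^ m ⊗ x ^ n
^-+ x zero n = sym (⊗-identityˡ (x ^ n))
^-+ x (suc m) n = trans (cong (x ⊗_) (^-+ x m n)) (sym (⊗-assoc x (x ^ m) (x ^ n)))

^-+-+ : ∀ x a b t → x ^ (a ℕ.+ b ℕ.+ t) ≡ x ^ a ⊗ x ^ b ⊗ x ^ t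
^-+-+ x a b t = trans (^-+ x (a ℕ.+ b) t) (cong (_⊗ x ^ t) (^-+ x a b))

^-double : ∀ x n → x ^ (2 ℕ.* n) ≡ x ^ n ⊗ x ^ n
^-double x n = trans (cong (x ^_) (cong (n ℕ.+_) (ℕP.+-identityʳ n))) (^-+ x n n)

^-distrib-⊗ : ∀ x y n → (x ⊗ y) ^ n ≡ x ^ n ⊗ y ^ n
^-distrib-⊗ x y zero = refl
^-distrib-⊗ x y (suc n) = trans (cong ((x ⊗ y) ⊗_) (^-distrib-⊗ x y n)) (identity x y (x ^ n) (y ^ n))
  where
  identity : ∀ x y u v → (x ⊗ y) ⊗ (u ⊗ v) ≡ (x ⊗ u) ⊗ (y ⊗ v)
  identity = solve-∀ ℚ√5-ring

one^ : ∀ n → one ^ n ≡ one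
one^ zero = refl
one^ (suc n) = trans (⊗-identityˡ (one ^ n)) (one^ n)

-- (φ ⊗ φ⁻¹) ^ n and one ^ n agree by computation.
φ^⊗φ⁻¹^ : ∀ n → φ ^ n ⊗ φ⁻¹ ^ n ≡ one
φ^⊗φ⁻¹^ n = trans (sym (^-distrib-⊗ φ φ⁻¹ n)) (one^ n)

φ^-neg : ∀ n → φ^ (ℤ.- + n) ≡ φ⁻¹ ^ n
φ^-neg zero = refl
φ^-neg (suc n) = refl

φ^-⊖ : ∀ m n → φ^ (m ℤ.⊖ n) ≡ φ ^ m ⊗ φ⁻¹ ^ n
φ^-⊖ m zero = sym (⊗-identityʳ (φ ^ m))
φ^-⊖ zero (suc n) = sym (⊗-identityˡ (φ⁻¹ ^ suc n))
φ^-⊖ (suc m) (suc n) = begin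
  φ^ (suc m ℤ.⊖ suc n)                 ≡⟨ cong φ^ (ℤP.[1+m]⊖[1+n]≡m⊖n m n) ⟩
  φ^ (m ℤ.⊖ n)                         ≡⟨ φ^-⊖ m n ⟩
  φ ^ m ⊗ φ⁻¹ ^ n                      ≡⟨ insert-φ⊗φ⁻¹ (φ ^ m) (φ⁻¹ ^ n) ⟩
  (φ ⊗ φ ^ m) ⊗ (φ⁻¹ ⊗ φ⁻¹ ^ n)        ∎
  where
  open ≡-Reasoning
  insert-φ⊗φ⁻¹ : ∀ u v → u ⊗ v ≡ (φ ⊗ u) ⊗ (φ⁻¹ ⊗ v)
  insert-φ⊗φ⁻¹ = solve-∀ ℚ√5-ring

φ^-sub : ∀ m n → φ^ (+ m ℤ.- + n) ≡ φ ^ m ⊗ φ⁻¹ ^ n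
φ^-sub m n = trans (cong φ^ (ℤP.m-n≡m⊖n m n)) (φ^-⊖ m n)

ψ^ : ∀ n → ψ ^ n ≡ (⊝ one) ^ n ⊗ φ⁻¹ ^ n
ψ^ = ^-distrib-⊗ (⊝ one) φ⁻¹

binet : ∀ n → ofℕ (F n) ⊗ √5 ≡ φ ^ n ⊖ ψ ^ n
binet zero = refl
binet (suc zero) = refl
binet (suc (suc n)) = begin
  ofℕ (F (suc n) ℕ.+ F n) ⊗ √5                  ≡⟨ cong (_⊗ √5) (ofℕ-homo-+ (F (suc n)) (F n)) ⟩
  (ofℕ (F (suc n)) ⊕ ofℕ (F n)) ⊗ √5            ≡⟨ ⊗-distribʳ-⊕ √5 (ofℕ (F (suc n))) (ofℕ (F n)) ⟩
  ofℕ (F (suc n)) ⊗ √5 ⊕ ofℕ (F n) ⊗ √5         ≡⟨ cong₂ _⊕_ (binet (suc n)) (binet n) ⟩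
  (φ ⊗ φ ^ n ⊖ ψ ⊗ ψ ^ n) ⊕ (φ ^ n ⊖ ψ ^ n)     ≡⟨ fibonacci-recurrence (φ ^ n) (ψ ^ n) ⟩
  φ ⊗ (φ ⊗ φ ^ n) ⊖ ψ ⊗ (ψ ⊗ ψ ^ n)             ∎
  where
  open ≡-Reasoning
  fibonacci-recurrence : ∀ u v → (φ ⊗ u ⊖ ψ ⊗ v) ⊕ (u ⊖ v) ≡ φ ⊗ (φ ⊗ u) ⊖ ψ ⊗ (ψ ⊗ v)
  fibonacci-recurrence = solve-∀ ℚ√5-ring

binet-φ⁻¹ : ∀ n → ofℕ (F n) ⊗ √5 ≡ φ ^ n ⊖ (⊝ one) ^ n ⊗ φ⁻¹ ^ n
binet-φ⁻¹ n = trans (binet n) (cong (φ ^ n ⊖_) (ψ^ n))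

1≼φ^ : ∀ n → one ≼ φ ^ n
1≼φ^ zero = ≼-decide
1≼φ^ (suc n) = begin
  one             ≤⟨ ≼-decide ⟩
  one ⊗ one       ≤⟨ *-mono-≼ {one} {φ} {one} ≼-decide ≼-decide ≼-decide (1≼φ^ n) ⟩
  φ ⊗ φ ^ n       ∎
  where open ≼-Reasoning

0≼φ^ : ∀ n → zero√ ≼ φ ^ n
0≼φ^ n = ≼-trans {y = one} ≼-decide (1≼φ^ n)

1≼φ^⊗φ^ : ∀ n → one ≼ φ ^ n ⊗ φ ^ n
1≼φ^⊗φ^ n = subst (one ≼_) (^-+ φ n n) (1≼φ^ (n ℕ.+ n))

φ^-mono : ∀ {m n} → m ℕ.≤ n → φ ^ m ≼ φ ^ n
φ^-mono {m} m≤n with ℕP.m≤n⇒∃[o]m+o≡n m≤n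
... | o , refl = subst₂ _≼_ (⊗-identityʳ (φ ^ m)) (sym (^-+ φ m o)) (*-monoˡ-≼ (0≼φ^ m) (1≼φ^ o))

0≼φ⁻¹^ : ∀ n → zero√ ≼ φ⁻¹ ^ n
0≼φ⁻¹^ zero = ≼-decide
0≼φ⁻¹^ (suc n) = 0≼-⊗ {φ⁻¹} ≼-decide (0≼φ⁻¹^ n)

φ⁻¹^≼1 : ∀ n → φ⁻¹ ^ n ≼ one
φ⁻¹^≼1 zero = ≼-decide
φ⁻¹^≼1 (suc n) = begin
  φ⁻¹ ⊗ φ⁻¹ ^ n   ≤⟨ *-mono-≼ {φ⁻¹} {one} ≼-decide (0≼φ⁻¹^ n) ≼-decide (φ⁻¹^≼1 n) ⟩
  one ⊗ one       ≤⟨ ≼-decide ⟩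
  one             ∎
  where open ≼-Reasoning

φ⁻¹^-square≼fifth : ∀ n → 2 ℕ.≤ n → φ⁻¹ ^ n ⊗ φ⁻¹ ^ n ≼ fifth
φ⁻¹^-square≼fifth (suc (suc m)) (s≤s (s≤s z≤n)) =
  begin
    φ⁻¹ ^ (2 ℕ.+ m) ⊗ φ⁻¹ ^ (2 ℕ.+ m)
      ≤⟨ *-mono-≼ (0≼φ⁻¹^ (2 ℕ.+ m)) (0≼φ⁻¹^ (2 ℕ.+ m)) φ⁻¹^≼φ⁻² φ⁻¹^≼φ⁻² ⟩
    φ⁻² ⊗ φ⁻²
      ≤⟨ ≼-decide ⟩
    fifth
      ∎
  where
  open ≼-Reasoning
  φ⁻² : ℚ√5
  φ⁻² = φ⁻¹ ⊗ (φ⁻¹ ⊗ one)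
  φ⁻¹^≼φ⁻² : φ⁻¹ ^ (2 ℕ.+ m) ≼ φ⁻²
  φ⁻¹^≼φ⁻² = *-monoˡ-≼ {φ⁻¹} ≼-decide (*-monoˡ-≼ {φ⁻¹} ≼-decide (φ⁻¹^≼1 m))

1≼3/√5⊗φ^ : ∀ t → 1 ℕ.≤ t → one ≼ 3/√5 ⊗ φ ^ t
1≼3/√5⊗φ^ (suc t) (s≤s z≤n) = begin
  one                       ≤⟨ ≼-decide ⟩
  3/√5 ⊗ (φ ⊗ one)          ≤⟨ *-monoˡ-≼ {3/√5} ≼-decide (*-monoˡ-≼ {φ} ≼-decide (1≼φ^ t)) ⟩
  3/√5 ⊗ (φ ⊗ φ ^ t)        ∎
  where open ≼-Reasoning

-- Signs and the algebra of the estimate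

data IsSign : ℚ√5 → Set where
  plus  : IsSign one
  minus : IsSign (⊝ one)

IsSign-⊗ : ∀ {ε δ} → IsSign ε → IsSign δ → IsSign (ε ⊗ δ)
IsSign-⊗ plus  plus  = plus
IsSign-⊗ plus  minus = minus
IsSign-⊗ minus plus  = minus
IsSign-⊗ minus minus = plus

IsSign-^ : ∀ n → IsSign ((⊝ one) ^ n)
IsSign-^ zero = plus
IsSign-^ (suc n) = IsSign-⊗ minus (IsSign-^ n)

sign⊗sign≡1 : ∀ {ε} → IsSign ε → ε ⊗ ε ≡ one
sign⊗sign≡1 plus  = refl
sign⊗sign≡1 minus = refl

sign≼1 : ∀ {ε} → IsSign ε → ε ≼ one
sign≼1 plus  = ≼-decide
sign≼1 minus = ≼-decide

0≼1⊕sign : ∀ {ε} → IsSign ε → zero√ ≼ one ⊕ ε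
0≼1⊕sign plus  = ≼-decide
0≼1⊕sign minus = ≼-decide

∣ε⊗u∣≼K : ∀ {ε u K} → IsSign ε → zero√ ≼ u → u ≼ K → zero√ ≼ K ⊖ ε ⊗ u × zero√ ≼ K ⊕ ε ⊗ u
∣ε⊗u∣≼K {_} {u} {K} plus 0≼u u≼K =
  subst (zero√ ≼_) (identity u K) (≼⇒0≼ u≼K) ,
  subst (zero√ ≼_) (identity′ u K) (0≼-⊕ (≼-trans 0≼u u≼K) 0≼u)
  where
  identity : ∀ u K → K ⊖ u ≡ K ⊖ one ⊗ u
  identity = solve-∀ ℚ√5-ring
  identity′ : ∀ u K → K ⊕ u ≡ K ⊕ one ⊗ u
  identity′ = solve-∀ ℚ√5-ring
∣ε⊗u∣≼K {_} {u} {K} minus 0≼u u≼K =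
  subst (zero√ ≼_) (identity u K) (0≼-⊕ (≼-trans 0≼u u≼K) 0≼u) ,
  subst (zero√ ≼_) (identity′ u K) (≼⇒0≼ u≼K)
  where
  identity : ∀ u K → K ⊕ u ≡ K ⊖ (⊝ one) ⊗ u
  identity = solve-∀ ℚ√5-ring
  identity′ : ∀ u K → K ⊖ u ≡ K ⊕ (⊝ one) ⊗ u
  identity′ = solve-∀ ℚ√5-ring

0≼1⊖εu≼6/5 : ∀ {ε u} → IsSign ε → zero√ ≼ u → u ≼ fifth → zero√ ≼ one ⊖ ε ⊗ u × one ⊖ ε ⊗ u ≼ six/5
0≼1⊖εu≼6/5 {ε} {u} sign-ε 0≼u u≼⅕ =
  subst (zero√ ≼_) (identity ε u) (0≼-⊕ (proj₁ bounds) ≼-decide) ,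
  0≼⇒≼ (subst (zero√ ≼_) (identity′ ε u) (proj₂ bounds))
  where
  bounds : zero√ ≼ fifth ⊖ ε ⊗ u × zero√ ≼ fifth ⊕ ε ⊗ u
  bounds = ∣ε⊗u∣≼K sign-ε 0≼u u≼⅕
  identity : ∀ ε u → (fifth ⊖ ε ⊗ u) ⊕ (one ⊖ fifth) ≡ one ⊖ ε ⊗ u
  identity = solve-∀ ℚ√5-ring
  identity′ : ∀ ε u → fifth ⊕ ε ⊗ u ≡ six/5 ⊖ (one ⊖ ε ⊗ u)
  identity′ = solve-∀ ℚ√5-ring

mixed-sign-nonNeg : ∀ {εa εb U V} → IsSign εa → IsSign εb → one ≼ U → one ≼ V →
                    zero√ ≼ (one ⊖ εb) ⊗ U ⊕ (one ⊖ εa) ⊗ V ⊕ εa ⊗ εb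
mixed-sign-nonNeg {U = U} {V} plus plus _ _ = begin
  zero√                                                   ≤⟨ ≼-decide ⟩
  one                                                     ≡⟨ solve (U ∷ V ∷ []) ℚ√5-ring ⟩
  (one ⊖ one) ⊗ U ⊕ (one ⊖ one) ⊗ V ⊕ one ⊗ one           ∎
  where open ≼-Reasoning
mixed-sign-nonNeg {U = U} {V} plus minus 1≼U _ = begin
  zero√                                                   ≤⟨ 0≼-⊕ (0≼-⊗ {two} ≼-decide (≼⇒0≼ 1≼U)) ≼-decide ⟩
  two ⊗ (U ⊖ one) ⊕ one                                   ≡⟨ solve (U ∷ V ∷ []) ℚ√5-ring ⟩
  (one ⊖ ⊝ one) ⊗ U ⊕ (one ⊖ one) ⊗ V ⊕ one ⊗ ⊝ one       ∎
  where open ≼-Reasoning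
mixed-sign-nonNeg {U = U} {V} minus plus _ 1≼V = begin
  zero√                                                   ≤⟨ 0≼-⊕ (0≼-⊗ {two} ≼-decide (≼⇒0≼ 1≼V)) ≼-decide ⟩
  two ⊗ (V ⊖ one) ⊕ one                                   ≡⟨ solve (U ∷ V ∷ []) ℚ√5-ring ⟩
  (one ⊖ one) ⊗ U ⊕ (one ⊖ ⊝ one) ⊗ V ⊕ ⊝ one ⊗ one       ∎
  where open ≼-Reasoning
mixed-sign-nonNeg {U = U} {V} minus minus 1≼U 1≼V = begin
  zero√
    ≤⟨ 0≼-⊕ (0≼-⊕ (0≼-⊗ {two} ≼-decide (≼⇒0≼ 1≼U)) (0≼-⊗ {two} ≼-decide (≼⇒0≼ 1≼V))) ≼-decide ⟩
  two ⊗ (U ⊖ one) ⊕ two ⊗ (V ⊖ one) ⊕ ofℤ (+ 5)           ≡⟨ solve (U ∷ V ∷ []) ℚ√5-ring ⟩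
  (one ⊖ ⊝ one) ⊗ U ⊕ (one ⊖ ⊝ one) ⊗ V ⊕ ⊝ one ⊗ ⊝ one   ∎
  where open ≼-Reasoning

square-expansion : ∀ U U′ ε → U ⊗ U′ ≡ one → ε ⊗ ε ≡ one →
                   (U ⊖ ε ⊗ U′) ⊗ (U ⊖ ε ⊗ U′) ≡ U ⊗ U ⊕ U′ ⊗ U′ ⊖ two ⊗ ε
square-expansion U U′ ε U⊗U′≡1 ε⊗ε≡1 = begin
  (U ⊖ ε ⊗ U′) ⊗ (U ⊖ ε ⊗ U′)                     ≡⟨ solve (U ∷ U′ ∷ ε ∷ []) ℚ√5-ring ⟩
  U ⊗ U ⊕ (ε ⊗ ε) ⊗ (U′ ⊗ U′) ⊖ two ⊗ ε ⊗ (U ⊗ U′) ≡⟨ cong₂ (λ e r → U ⊗ U ⊕ e ⊗ (U′ ⊗ U′) ⊖ two ⊗ ε ⊗ r) ε⊗ε≡1 U⊗U′≡1 ⟩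
  U ⊗ U ⊕ one ⊗ (U′ ⊗ U′) ⊖ two ⊗ ε ⊗ one         ≡⟨ solve (U ∷ U′ ∷ ε ∷ []) ℚ√5-ring ⟩
  U ⊗ U ⊕ U′ ⊗ U′ ⊖ two ⊗ ε                       ∎
  where open ≡-Reasoning

triple-product-expansion : ∀ X X′ Y Y′ T T′ εa εb εc → X ⊗ X′ ≡ one → Y ⊗ Y′ ≡ one →
  (X ⊖ εa ⊗ X′) ⊗ (Y ⊖ εb ⊗ Y′) ⊗ (X ⊗ Y ⊗ T ⊖ εc ⊗ (X′ ⊗ Y′ ⊗ T′))
  ≡ X ⊗ X ⊗ (Y ⊗ Y) ⊗ T ⊖ T ⊗ (εb ⊗ (X ⊗ X) ⊕ εa ⊗ (Y ⊗ Y)) ⊕ εa ⊗ εb ⊗ T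
    ⊖ εc ⊗ (T′ ⊗ (one ⊖ εa ⊗ (X′ ⊗ X′)) ⊗ (one ⊖ εb ⊗ (Y′ ⊗ Y′)))
triple-product-expansion X X′ Y Y′ T T′ εa εb εc X⊗X′≡1 Y⊗Y′≡1 = begin
  (X ⊖ εa ⊗ X′) ⊗ (Y ⊖ εb ⊗ Y′) ⊗ (X ⊗ Y ⊗ T ⊖ εc ⊗ (X′ ⊗ Y′ ⊗ T′))
    ≡⟨ solve vars ℚ√5-ring ⟩
  X ⊗ X ⊗ (Y ⊗ Y) ⊗ T ⊖ εb ⊗ (X ⊗ X) ⊗ T ⊗ (Y ⊗ Y′) ⊖ εa ⊗ (Y ⊗ Y) ⊗ T ⊗ (X ⊗ X′)
    ⊕ εa ⊗ εb ⊗ T ⊗ (X ⊗ X′) ⊗ (Y ⊗ Y′) ⊖ εc ⊗ T′ ⊗ (X ⊗ X′) ⊗ (Y ⊗ Y′)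
    ⊕ εb ⊗ εc ⊗ (Y′ ⊗ Y′) ⊗ T′ ⊗ (X ⊗ X′) ⊕ εa ⊗ εc ⊗ (X′ ⊗ X′) ⊗ T′ ⊗ (Y ⊗ Y′)
    ⊖ εa ⊗ εb ⊗ εc ⊗ (X′ ⊗ X′) ⊗ (Y′ ⊗ Y′) ⊗ T′
    ≡⟨ cong₂ expanded X⊗X′≡1 Y⊗Y′≡1 ⟩
  X ⊗ X ⊗ (Y ⊗ Y) ⊗ T ⊖ εb ⊗ (X ⊗ X) ⊗ T ⊗ one ⊖ εa ⊗ (Y ⊗ Y) ⊗ T ⊗ one
    ⊕ εa ⊗ εb ⊗ T ⊗ one ⊗ one ⊖ εc ⊗ T′ ⊗ one ⊗ one
    ⊕ εb ⊗ εc ⊗ (Y′ ⊗ Y′) ⊗ T′ ⊗ one ⊕ εa ⊗ εc ⊗ (X′ ⊗ X′) ⊗ T′ ⊗ one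
    ⊖ εa ⊗ εb ⊗ εc ⊗ (X′ ⊗ X′) ⊗ (Y′ ⊗ Y′) ⊗ T′
    ≡⟨ solve vars ℚ√5-ring ⟩
  X ⊗ X ⊗ (Y ⊗ Y) ⊗ T ⊖ T ⊗ (εb ⊗ (X ⊗ X) ⊕ εa ⊗ (Y ⊗ Y)) ⊕ εa ⊗ εb ⊗ T
    ⊖ εc ⊗ (T′ ⊗ (one ⊖ εa ⊗ (X′ ⊗ X′)) ⊗ (one ⊖ εb ⊗ (Y′ ⊗ Y′)))
    ∎
  where
  open ≡-Reasoning
  vars : List ℚ√5
  vars = X ∷ X′ ∷ Y ∷ Y′ ∷ T ∷ T′ ∷ εa ∷ εb ∷ εc ∷ []
  expanded : ℚ√5 → ℚ√5 → ℚ√5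
  expanded u v =
    X ⊗ X ⊗ (Y ⊗ Y) ⊗ T ⊖ εb ⊗ (X ⊗ X) ⊗ T ⊗ v ⊖ εa ⊗ (Y ⊗ Y) ⊗ T ⊗ u
    ⊕ εa ⊗ εb ⊗ T ⊗ u ⊗ v ⊖ εc ⊗ T′ ⊗ u ⊗ v
    ⊕ εb ⊗ εc ⊗ (Y′ ⊗ Y′) ⊗ T′ ⊗ u ⊕ εa ⊗ εc ⊗ (X′ ⊗ X′) ⊗ T′ ⊗ v
    ⊖ εa ⊗ εb ⊗ εc ⊗ (X′ ⊗ X′) ⊗ (Y′ ⊗ Y′) ⊗ T′

-- 5 (u² + v² + w² − 3 u v w) = Q√5 (√5 u) (√5 v) (√5 w).
Q√5 : ℚ√5 → ℚ√5 → ℚ√5 → ℚ√5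
Q√5 x y z = x ⊗ x ⊕ y ⊗ y ⊕ z ⊗ z ⊖ 3/√5 ⊗ (x ⊗ y ⊗ z)

-- Q√5 x y z − lower and upper − Q√5 x y z of Estimate, with Q√5 x y z expanded as in Q√5-expansion,
-- written as sums of terms that are nonnegative under the hypotheses of Estimate.
lower-gap : ∀ X X′ Y Y′ Z Z′ T W P εa εb εc M H →
  (3/√5 ⊗ T ⊖ one) ⊗ (M ⊖ (X ⊗ X ⊕ Y ⊗ Y))
    ⊕ 3/√5 ⊗ T ⊗ ((one ⊕ εb) ⊗ (X ⊗ X) ⊕ (one ⊕ εa) ⊗ (Y ⊗ Y))
    ⊕ 3/√5 ⊗ T ⊗ (H ⊖ εa ⊗ εb)
    ⊕ two ⊗ ((H ⊖ εa) ⊕ (H ⊖ εb) ⊕ (H ⊖ εc))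
    ⊕ (X′ ⊗ X′ ⊕ Y′ ⊗ Y′ ⊕ Z′ ⊗ Z′)
    ⊕ 3/√5 ⊗ (three ⊗ H ⊕ εc ⊗ P)
  ≡ (X ⊗ X ⊕ X′ ⊗ X′ ⊖ two ⊗ εa) ⊕ (Y ⊗ Y ⊕ Y′ ⊗ Y′ ⊖ two ⊗ εb) ⊕ (Z ⊗ Z ⊕ Z′ ⊗ Z′ ⊖ two ⊗ εc)
      ⊖ 3/√5 ⊗ (W ⊖ T ⊗ (εb ⊗ (X ⊗ X) ⊕ εa ⊗ (Y ⊗ Y)) ⊕ εa ⊗ εb ⊗ T ⊖ εc ⊗ P)
    ⊖ (Z ⊗ Z ⊖ 3/√5 ⊗ W ⊕ (one ⊖ 3/√5 ⊗ T) ⊗ M ⊖ (six ⊕ 3/√5 ⊗ T ⊕ 9/√5) ⊗ H)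
lower-gap = solve-∀ ℚ√5-ring

upper-gap : ∀ X X′ Y Y′ Z Z′ T W P εa εb εc M H →
  (one ⊕ 3/√5 ⊗ T) ⊗ (M ⊖ (X ⊗ X ⊕ Y ⊗ Y))
    ⊕ 3/√5 ⊗ T ⊗ ((one ⊖ εb) ⊗ (X ⊗ X) ⊕ (one ⊖ εa) ⊗ (Y ⊗ Y) ⊕ εa ⊗ εb)
    ⊕ nine ⊗ (H ⊖ one)
    ⊕ two ⊗ ((one ⊕ εa) ⊕ (one ⊕ εb) ⊕ (one ⊕ εc))
    ⊕ ((fifth ⊖ X′ ⊗ X′) ⊕ (fifth ⊖ Y′ ⊗ Y′) ⊕ (fifth ⊖ Z′ ⊗ Z′))
    ⊕ (12/5 ⊖ 3/√5 ⊗ 36/25) ⊕ 3/√5 ⊗ (36/25 ⊖ εc ⊗ P)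
  ≡ (Z ⊗ Z ⊖ 3/√5 ⊗ W ⊕ (one ⊕ 3/√5 ⊗ T) ⊗ M ⊕ nine ⊗ H)
    ⊖ ((X ⊗ X ⊕ X′ ⊗ X′ ⊖ two ⊗ εa) ⊕ (Y ⊗ Y ⊕ Y′ ⊗ Y′ ⊖ two ⊗ εb) ⊕ (Z ⊗ Z ⊕ Z′ ⊗ Z′ ⊖ two ⊗ εc)
      ⊖ 3/√5 ⊗ (W ⊖ T ⊗ (εb ⊗ (X ⊗ X) ⊕ εa ⊗ (Y ⊗ Y)) ⊕ εa ⊗ εb ⊗ T ⊖ εc ⊗ P))
upper-gap = solve-∀ ℚ√5-ring

-- With X = φᵃ, X′ = φ⁻ᵃ, εa = (−1)ᵃ and likewise for b and t, Binet's formula makes x, y, z equal to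
-- √5 F(a), √5 F(b), √5 F(c) for c = a + b + t, and lower, upper become L φ²ᶜ and U φ²ᶜ once M and H
-- stand for φ²ᶜ (φ^(−2t−2A) + φ^(2A−2C)) and φ²ᶜ φ^(−2C).
module Estimate
  (X X′ Y Y′ T T′ εa εb εt M H : ℚ√5)
  (X⊗X′≡1 : X ⊗ X′ ≡ one) (Y⊗Y′≡1 : Y ⊗ Y′ ≡ one) (T⊗T′≡1 : T ⊗ T′ ≡ one)
  (sign-a : IsSign εa) (sign-b : IsSign εb) (sign-t : IsSign εt)
  (1≼X² : one ≼ X ⊗ X) (1≼Y² : one ≼ Y ⊗ Y) (1≼3/√5⊗T : one ≼ 3/√5 ⊗ T)
  (0≼T′ : zero√ ≼ T′) (T′≼1 : T′ ≼ one)
  (X′²≼⅕ : X′ ⊗ X′ ≼ fifth) (Y′²≼⅕ : Y′ ⊗ Y′ ≼ fifth)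
  (Z′²≼⅕ : (X′ ⊗ Y′ ⊗ T′) ⊗ (X′ ⊗ Y′ ⊗ T′) ≼ fifth)
  (X²+Y²≼M : X ⊗ X ⊕ Y ⊗ Y ≼ M) (1≼H : one ≼ H)
  where

  Z Z′ εc x y z W P lower upper : ℚ√5
  Z = X ⊗ Y ⊗ T
  Z′ = X′ ⊗ Y′ ⊗ T′
  εc = εa ⊗ εb ⊗ εt
  x = X ⊖ εa ⊗ X′
  y = Y ⊖ εb ⊗ Y′
  z = Z ⊖ εc ⊗ Z′
  W = X ⊗ X ⊗ (Y ⊗ Y) ⊗ T
  P = T′ ⊗ (one ⊖ εa ⊗ (X′ ⊗ X′)) ⊗ (one ⊖ εb ⊗ (Y′ ⊗ Y′))
  lower = Z ⊗ Z ⊖ 3/√5 ⊗ W ⊕ (one ⊖ 3/√5 ⊗ T) ⊗ M ⊖ (six ⊕ 3/√5 ⊗ T ⊕ 9/√5) ⊗ H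
  upper = Z ⊗ Z ⊖ 3/√5 ⊗ W ⊕ (one ⊕ 3/√5 ⊗ T) ⊗ M ⊕ nine ⊗ H

  sign-c : IsSign εc
  sign-c = IsSign-⊗ (IsSign-⊗ sign-a sign-b) sign-t

  Z⊗Z′≡1 : Z ⊗ Z′ ≡ one
  Z⊗Z′≡1 = begin
    X ⊗ Y ⊗ T ⊗ (X′ ⊗ Y′ ⊗ T′)        ≡⟨ solve (X ∷ X′ ∷ Y ∷ Y′ ∷ T ∷ T′ ∷ []) ℚ√5-ring ⟩
    (X ⊗ X′) ⊗ (Y ⊗ Y′) ⊗ (T ⊗ T′)    ≡⟨ cong₂ _⊗_ (cong₂ _⊗_ X⊗X′≡1 Y⊗Y′≡1) T⊗T′≡1 ⟩
    one ⊗ one ⊗ one                   ≡⟨⟩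
    one                               ∎
    where open ≡-Reasoning

  Q√5-expansion : Q√5 x y z
                ≡ (X ⊗ X ⊕ X′ ⊗ X′ ⊖ two ⊗ εa) ⊕ (Y ⊗ Y ⊕ Y′ ⊗ Y′ ⊖ two ⊗ εb) ⊕ (Z ⊗ Z ⊕ Z′ ⊗ Z′ ⊖ two ⊗ εc)
                  ⊖ 3/√5 ⊗ (W ⊖ T ⊗ (εb ⊗ (X ⊗ X) ⊕ εa ⊗ (Y ⊗ Y)) ⊕ εa ⊗ εb ⊗ T ⊖ εc ⊗ P)
  Q√5-expansion = cong₂ _⊖_
    (cong₂ _⊕_ (cong₂ _⊕_ (square-expansion X X′ εa X⊗X′≡1 (sign⊗sign≡1 sign-a))
                          (square-expansion Y Y′ εb Y⊗Y′≡1 (sign⊗sign≡1 sign-b)))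
               (square-expansion Z Z′ εc Z⊗Z′≡1 (sign⊗sign≡1 sign-c)))
    (cong (3/√5 ⊗_) (triple-product-expansion X X′ Y Y′ T T′ εa εb εc X⊗X′≡1 Y⊗Y′≡1))

  0≼3/√5⊗T : zero√ ≼ 3/√5 ⊗ T
  0≼3/√5⊗T = ≼-trans {y = one} ≼-decide 1≼3/√5⊗T

  H-sign-nonNeg : ∀ {ε} → IsSign ε → zero√ ≼ H ⊖ ε
  H-sign-nonNeg sign-ε = ≼⇒0≼ (≼-trans (sign≼1 sign-ε) 1≼H)

  sign⊗P-bounds : zero√ ≼ 36/25 ⊖ εc ⊗ P × zero√ ≼ 36/25 ⊕ εc ⊗ P
  sign⊗P-bounds = ∣ε⊗u∣≼K sign-c 0≼P P≼36/25
    where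
    factor-a : zero√ ≼ one ⊖ εa ⊗ (X′ ⊗ X′) × one ⊖ εa ⊗ (X′ ⊗ X′) ≼ six/5
    factor-a = 0≼1⊖εu≼6/5 sign-a (0≼-square X′) X′²≼⅕
    factor-b : zero√ ≼ one ⊖ εb ⊗ (Y′ ⊗ Y′) × one ⊖ εb ⊗ (Y′ ⊗ Y′) ≼ six/5
    factor-b = 0≼1⊖εu≼6/5 sign-b (0≼-square Y′) Y′²≼⅕
    0≼P : zero√ ≼ P
    0≼P = 0≼-⊗ (0≼-⊗ 0≼T′ (proj₁ factor-a)) (proj₁ factor-b)
    P≼36/25 : P ≼ 36/25
    P≼36/25 = begin
      P                        ≤⟨ *-mono-≼ (0≼-⊗ 0≼T′ (proj₁ factor-a)) (proj₁ factor-b)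
                                    (*-mono-≼ 0≼T′ (proj₁ factor-a) T′≼1 (proj₂ factor-a)) (proj₂ factor-b) ⟩
      one ⊗ six/5 ⊗ six/5      ≤⟨ ≼-decide ⟩
      36/25                    ∎
      where open ≼-Reasoning

  lower-bound : lower ≼ Q√5 x y z
  lower-bound = 0≼⇒≼ (subst (zero√ ≼_)
    (trans (lower-gap X X′ Y Y′ Z Z′ T W P εa εb εc M H) (cong (_⊖ lower) (sym Q√5-expansion)))
    (0≼-⊕ (0≼-⊕ (0≼-⊕ (0≼-⊕ (0≼-⊕
      (0≼-⊗ (≼⇒0≼ 1≼3/√5⊗T) (≼⇒0≼ X²+Y²≼M))
      (0≼-⊗ 0≼3/√5⊗T (0≼-⊕ (0≼-⊗ (0≼1⊕sign sign-b) (0≼-square X)) (0≼-⊗ (0≼1⊕sign sign-a) (0≼-square Y)))))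
      (0≼-⊗ 0≼3/√5⊗T (H-sign-nonNeg (IsSign-⊗ sign-a sign-b))))
      (0≼-⊗ {two} ≼-decide (0≼-⊕ (0≼-⊕ (H-sign-nonNeg sign-a) (H-sign-nonNeg sign-b)) (H-sign-nonNeg sign-c))))
      (0≼-⊕ (0≼-⊕ (0≼-square X′) (0≼-square Y′)) (0≼-square Z′)))
      (0≼-⊗ {3/√5} ≼-decide 0≼3H⊕εcP)))
    where
    regroup : ∀ H p → (three ⊗ H ⊖ 36/25) ⊕ (36/25 ⊕ p) ≡ three ⊗ H ⊕ p
    regroup = solve-∀ ℚ√5-ring
    36/25≼3H : 36/25 ≼ three ⊗ H
    36/25≼3H = begin
      36/25        ≤⟨ ≼-decide ⟩
      three ⊗ one  ≤⟨ *-monoˡ-≼ {three} ≼-decide 1≼H ⟩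
      three ⊗ H    ∎
      where open ≼-Reasoning
    0≼3H⊕εcP : zero√ ≼ three ⊗ H ⊕ εc ⊗ P
    0≼3H⊕εcP = subst (zero√ ≼_) (regroup H (εc ⊗ P)) (0≼-⊕ (≼⇒0≼ 36/25≼3H) (proj₂ sign⊗P-bounds))

  upper-bound : Q√5 x y z ≼ upper
  upper-bound = 0≼⇒≼ (subst (zero√ ≼_)
    (trans (upper-gap X X′ Y Y′ Z Z′ T W P εa εb εc M H) (cong (upper ⊖_) (sym Q√5-expansion)))
    (0≼-⊕ (0≼-⊕ (0≼-⊕ (0≼-⊕ (0≼-⊕ (0≼-⊕
      (0≼-⊗ (0≼-⊕ {one} ≼-decide 0≼3/√5⊗T) (≼⇒0≼ X²+Y²≼M))
      (0≼-⊗ 0≼3/√5⊗T (mixed-sign-nonNeg sign-a sign-b 1≼X² 1≼Y²)))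
      (0≼-⊗ {nine} ≼-decide (≼⇒0≼ 1≼H)))
      (0≼-⊗ {two} ≼-decide (0≼-⊕ (0≼-⊕ (0≼1⊕sign sign-a) (0≼1⊕sign sign-b)) (0≼1⊕sign sign-c))))
      (0≼-⊕ (0≼-⊕ (≼⇒0≼ X′²≼⅕) (≼⇒0≼ Y′²≼⅕)) (≼⇒0≼ Z′²≼⅕)))
      (≼-decide {zero√} {12/5 ⊖ 3/√5 ⊗ 36/25}))
      (0≼-⊗ {3/√5} ≼-decide (proj₁ sign⊗P-bounds))))

Q≡⅕Q√5 : ∀ a b c → ofℤ (Q a b c) ≡ fifth ⊗ Q√5 (ofℕ (F a) ⊗ √5) (ofℕ (F b) ⊗ √5) (ofℕ (F c) ⊗ √5)
Q≡⅕Q√5 a b c = begin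
  ofℤ (+ (F a ℕ.* F a ℕ.+ F b ℕ.* F b ℕ.+ F c ℕ.* F c) ℤ.- + (3 ℕ.* F a ℕ.* F b ℕ.* F c))
    ≡⟨ ofℤ-homo-- (+ (F a ℕ.* F a ℕ.+ F b ℕ.* F b ℕ.+ F c ℕ.* F c)) (+ (3 ℕ.* F a ℕ.* F b ℕ.* F c)) ⟩
  ofℕ (F a ℕ.* F a ℕ.+ F b ℕ.* F b ℕ.+ F c ℕ.* F c) ⊖ ofℕ (3 ℕ.* F a ℕ.* F b ℕ.* F c)
    ≡⟨ cong₂ _⊖_ sum-of-squares triple-product ⟩
  u ⊗ u ⊕ v ⊗ v ⊕ w ⊗ w ⊖ ofℕ 3 ⊗ u ⊗ v ⊗ w
    ≡⟨ rescale u v w ⟩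
  fifth ⊗ Q√5 (u ⊗ √5) (v ⊗ √5) (w ⊗ √5)
    ∎
  where
  open ≡-Reasoning
  u v w : ℚ√5
  u = ofℕ (F a)
  v = ofℕ (F b)
  w = ofℕ (F c)
  square : ∀ n → ofℕ (n ℕ.* n) ≡ ofℕ n ⊗ ofℕ n
  square n = ofℕ-homo-* n n
  sum-of-squares : ofℕ (F a ℕ.* F a ℕ.+ F b ℕ.* F b ℕ.+ F c ℕ.* F c) ≡ u ⊗ u ⊕ v ⊗ v ⊕ w ⊗ w
  sum-of-squares = trans (ofℕ-homo-+ (F a ℕ.* F a ℕ.+ F b ℕ.* F b) (F c ℕ.* F c))
    (cong₂ _⊕_ (trans (ofℕ-homo-+ (F a ℕ.* F a) (F b ℕ.* F b)) (cong₂ _⊕_ (square (F a)) (square (F b))))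
               (square (F c)))
  triple-product : ofℕ (3 ℕ.* F a ℕ.* F b ℕ.* F c) ≡ ofℕ 3 ⊗ u ⊗ v ⊗ w
  triple-product = trans (ofℕ-homo-* (3 ℕ.* F a ℕ.* F b) (F c))
    (cong (_⊗ w) (trans (ofℕ-homo-* (3 ℕ.* F a) (F b)) (cong (_⊗ v) (ofℕ-homo-* 3 (F a)))))
  rescale : ∀ u v w → u ⊗ u ⊕ v ⊗ v ⊕ w ⊗ w ⊖ ofℕ 3 ⊗ u ⊗ v ⊗ w
                    ≡ fifth ⊗ ((u ⊗ √5) ⊗ (u ⊗ √5) ⊕ (v ⊗ √5) ⊗ (v ⊗ √5) ⊕ (w ⊗ √5) ⊗ (w ⊗ √5)
                               ⊖ 3/√5 ⊗ ((u ⊗ √5) ⊗ (v ⊗ √5) ⊗ (w ⊗ √5)))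
  rescale = solve-∀ ℚ√5-ring

Q-binet : ∀ a b t → ofℤ (Q a b (a ℕ.+ b ℕ.+ t))
  ≡ fifth ⊗ Q√5 (φ ^ a ⊖ (⊝ one) ^ a ⊗ φ⁻¹ ^ a) (φ ^ b ⊖ (⊝ one) ^ b ⊗ φ⁻¹ ^ b)
                (φ ^ a ⊗ φ ^ b ⊗ φ ^ t ⊖ (⊝ one) ^ a ⊗ (⊝ one) ^ b ⊗ (⊝ one) ^ t ⊗ (φ⁻¹ ^ a ⊗ φ⁻¹ ^ b ⊗ φ⁻¹ ^ t))
Q-binet a b t = trans (Q≡⅕Q√5 a b c) (cong (fifth ⊗_) (cong₃ Q√5 (binet-φ⁻¹ a) (binet-φ⁻¹ b) binet-c))
  where
  c : ℕ
  c = a ℕ.+ b ℕ.+ t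
  cong₃ : ∀ (f : ℚ√5 → ℚ√5 → ℚ√5 → ℚ√5) {x x′ y y′ z z′} →
          x ≡ x′ → y ≡ y′ → z ≡ z′ → f x y z ≡ f x′ y′ z′
  cong₃ f refl refl refl = refl
  binet-c : ofℕ (F c) ⊗ √5
          ≡ φ ^ a ⊗ φ ^ b ⊗ φ ^ t ⊖ (⊝ one) ^ a ⊗ (⊝ one) ^ b ⊗ (⊝ one) ^ t ⊗ (φ⁻¹ ^ a ⊗ φ⁻¹ ^ b ⊗ φ⁻¹ ^ t)
  binet-c = trans (binet-φ⁻¹ c)
    (cong₃ (λ p s q → p ⊖ s ⊗ q) (^-+-+ φ a b t) (^-+-+ (⊝ one) a b t) (^-+-+ φ⁻¹ a b t))

M-term : ℕ → ℕ → ℕ → ℕ → ℚ√5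
M-term A t C c =
  φ^ (ℤ.- + (2 ℕ.* t ℕ.+ 2 ℕ.* A)) ⊗ φ ^ (2 ℕ.* c) ⊕ φ^ (+ (2 ℕ.* A) ℤ.- + (2 ℕ.* C)) ⊗ φ ^ (2 ℕ.* c)

H-term : ℕ → ℕ → ℚ√5
H-term C c = φ^ (ℤ.- + (2 ℕ.* C)) ⊗ φ ^ (2 ℕ.* c)

φ^-double-+-+ : ∀ a b t → φ ^ (2 ℕ.* (a ℕ.+ b ℕ.+ t)) ≡ (φ ^ a ⊗ φ ^ b ⊗ φ ^ t) ⊗ (φ ^ a ⊗ φ ^ b ⊗ φ ^ t)
φ^-double-+-+ a b t = trans (^-double φ (a ℕ.+ b ℕ.+ t)) (cong (λ z → z ⊗ z) (^-+-+ φ a b t))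

T′⊗Z²≡W : ∀ X Y T T′ → T ⊗ T′ ≡ one → T′ ⊗ ((X ⊗ Y ⊗ T) ⊗ (X ⊗ Y ⊗ T)) ≡ X ⊗ X ⊗ (Y ⊗ Y) ⊗ T
T′⊗Z²≡W X Y T T′ T⊗T′≡1 = begin
  T′ ⊗ ((X ⊗ Y ⊗ T) ⊗ (X ⊗ Y ⊗ T))   ≡⟨ solve (X ∷ Y ∷ T ∷ T′ ∷ []) ℚ√5-ring ⟩
  X ⊗ X ⊗ (Y ⊗ Y) ⊗ T ⊗ (T ⊗ T′)     ≡⟨ cong (X ⊗ X ⊗ (Y ⊗ Y) ⊗ T ⊗_) T⊗T′≡1 ⟩
  X ⊗ X ⊗ (Y ⊗ Y) ⊗ T ⊗ one          ≡⟨ ⊗-identityʳ (X ⊗ X ⊗ (Y ⊗ Y) ⊗ T) ⟩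
  X ⊗ X ⊗ (Y ⊗ Y) ⊗ T                ∎
  where open ≡-Reasoning

T′²β′⊗Z²≡X²Y²β′ : ∀ X Y T T′ β′ → T ⊗ T′ ≡ one →
                  (T′ ⊗ T′ ⊗ β′) ⊗ ((X ⊗ Y ⊗ T) ⊗ (X ⊗ Y ⊗ T)) ≡ X ⊗ X ⊗ (Y ⊗ Y) ⊗ β′
T′²β′⊗Z²≡X²Y²β′ X Y T T′ β′ T⊗T′≡1 = begin
  (T′ ⊗ T′ ⊗ β′) ⊗ ((X ⊗ Y ⊗ T) ⊗ (X ⊗ Y ⊗ T))   ≡⟨ solve (X ∷ Y ∷ T ∷ T′ ∷ β′ ∷ []) ℚ√5-ring ⟩
  X ⊗ X ⊗ (Y ⊗ Y) ⊗ β′ ⊗ ((T ⊗ T′) ⊗ (T ⊗ T′))   ≡⟨ cong (λ r → X ⊗ X ⊗ (Y ⊗ Y) ⊗ β′ ⊗ (r ⊗ r)) T⊗T′≡1 ⟩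
  X ⊗ X ⊗ (Y ⊗ Y) ⊗ β′ ⊗ (one ⊗ one)             ≡⟨ ⊗-identityʳ (X ⊗ X ⊗ (Y ⊗ Y) ⊗ β′) ⟩
  X ⊗ X ⊗ (Y ⊗ Y) ⊗ β′                           ∎
  where open ≡-Reasoning

φ⁻ᵗ⊗φ²ᶜ : ∀ a b t → φ^ (ℤ.- + t) ⊗ φ ^ (2 ℕ.* (a ℕ.+ b ℕ.+ t)) ≡ φ ^ a ⊗ φ ^ a ⊗ (φ ^ b ⊗ φ ^ b) ⊗ φ ^ t
φ⁻ᵗ⊗φ²ᶜ a b t =
  trans (cong₂ _⊗_ (φ^-neg t) (φ^-double-+-+ a b t)) (T′⊗Z²≡W (φ ^ a) (φ ^ b) (φ ^ t) (φ⁻¹ ^ t) (φ^⊗φ⁻¹^ t))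

L-scaled : ∀ A t C a b → L A t C ⊗ fifthφ2 (a ℕ.+ b ℕ.+ t)
  ≡ fifth ⊗ ((φ ^ a ⊗ φ ^ b ⊗ φ ^ t) ⊗ (φ ^ a ⊗ φ ^ b ⊗ φ ^ t) ⊖ 3/√5 ⊗ (φ ^ a ⊗ φ ^ a ⊗ (φ ^ b ⊗ φ ^ b) ⊗ φ ^ t)
             ⊕ (one ⊖ 3/√5 ⊗ φ ^ t) ⊗ M-term A t C (a ℕ.+ b ℕ.+ t)
             ⊖ (six ⊕ 3/√5 ⊗ φ ^ t ⊕ 9/√5) ⊗ H-term C (a ℕ.+ b ℕ.+ t))
L-scaled A t C a b = trans
  (distribute (φ^ (ℤ.- + t)) (φ^ (ℤ.- + (2 ℕ.* t ℕ.+ 2 ℕ.* A))) (φ^ (+ (2 ℕ.* A) ℤ.- + (2 ℕ.* C))) (φ^ (ℤ.- + (2 ℕ.* C)))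
              (φ ^ t) (φ ^ (2 ℕ.* (a ℕ.+ b ℕ.+ t))))
  (cong₂ (λ s w → fifth ⊗ (s ⊖ 3/√5 ⊗ w ⊕ (one ⊖ 3/√5 ⊗ φ ^ t) ⊗ M-term A t C (a ℕ.+ b ℕ.+ t)
                                        ⊖ (six ⊕ 3/√5 ⊗ φ ^ t ⊕ 9/√5) ⊗ H-term C (a ℕ.+ b ℕ.+ t)))
         (φ^-double-+-+ a b t) (φ⁻ᵗ⊗φ²ᶜ a b t))
  where
  distribute : ∀ y₁ y₂ y₃ y₄ T S →
    (one ⊖ 3/√5 ⊗ y₁ ⊕ (one ⊖ 3/√5 ⊗ T) ⊗ (y₂ ⊕ y₃) ⊖ (six ⊕ 3/√5 ⊗ T ⊕ 9/√5) ⊗ y₄) ⊗ (fifth ⊗ S)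
    ≡ fifth ⊗ (S ⊖ 3/√5 ⊗ (y₁ ⊗ S) ⊕ (one ⊖ 3/√5 ⊗ T) ⊗ (y₂ ⊗ S ⊕ y₃ ⊗ S) ⊖ (six ⊕ 3/√5 ⊗ T ⊕ 9/√5) ⊗ (y₄ ⊗ S))
  distribute = solve-∀ ℚ√5-ring

U-scaled : ∀ A t C a b → U A t C ⊗ fifthφ2 (a ℕ.+ b ℕ.+ t)
  ≡ fifth ⊗ ((φ ^ a ⊗ φ ^ b ⊗ φ ^ t) ⊗ (φ ^ a ⊗ φ ^ b ⊗ φ ^ t) ⊖ 3/√5 ⊗ (φ ^ a ⊗ φ ^ a ⊗ (φ ^ b ⊗ φ ^ b) ⊗ φ ^ t)
             ⊕ (one ⊕ 3/√5 ⊗ φ ^ t) ⊗ M-term A t C (a ℕ.+ b ℕ.+ t)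
             ⊕ nine ⊗ H-term C (a ℕ.+ b ℕ.+ t))
U-scaled A t C a b = trans
  (distribute (φ^ (ℤ.- + t)) (φ^ (ℤ.- + (2 ℕ.* t ℕ.+ 2 ℕ.* A))) (φ^ (+ (2 ℕ.* A) ℤ.- + (2 ℕ.* C))) (φ^ (ℤ.- + (2 ℕ.* C)))
              (φ ^ t) (φ ^ (2 ℕ.* (a ℕ.+ b ℕ.+ t))))
  (cong₂ (λ s w → fifth ⊗ (s ⊖ 3/√5 ⊗ w ⊕ (one ⊕ 3/√5 ⊗ φ ^ t) ⊗ M-term A t C (a ℕ.+ b ℕ.+ t)
                                        ⊕ nine ⊗ H-term C (a ℕ.+ b ℕ.+ t)))
         (φ^-double-+-+ a b t) (φ⁻ᵗ⊗φ²ᶜ a b t))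
  where
  distribute : ∀ y₁ y₂ y₃ y₄ T S →
    (one ⊖ 3/√5 ⊗ y₁ ⊕ (one ⊕ 3/√5 ⊗ T) ⊗ (y₂ ⊕ y₃) ⊕ nine ⊗ y₄) ⊗ (fifth ⊗ S)
    ≡ fifth ⊗ (S ⊖ 3/√5 ⊗ (y₁ ⊗ S) ⊕ (one ⊕ 3/√5 ⊗ T) ⊗ (y₂ ⊗ S ⊕ y₃ ⊗ S) ⊕ nine ⊗ (y₄ ⊗ S))
  distribute = solve-∀ ℚ√5-ring

u⊕v≼uvβ′⊕βh : ∀ {u v β β′ h} → β ⊗ β′ ≡ one → zero√ ≼ β → zero√ ≼ β′ → β ≼ u → β ≼ v → one ≼ h →
               u ⊕ v ≼ u ⊗ v ⊗ β′ ⊕ β ⊗ h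
u⊕v≼uvβ′⊕βh {u} {v} {β} {β′} {h} β⊗β′≡1 0≼β 0≼β′ β≼u β≼v 1≼h = 0≼⇒≼ (subst (zero√ ≼_) gap
  (0≼-⊕ (0≼-⊗ (0≼-⊗ 0≼β′ (≼⇒0≼ β≼u)) (≼⇒0≼ β≼v)) (0≼-⊗ 0≼β (≼⇒0≼ 1≼h))))
  where
  open ≡-Reasoning
  gap : β′ ⊗ (u ⊖ β) ⊗ (v ⊖ β) ⊕ β ⊗ (h ⊖ one) ≡ u ⊗ v ⊗ β′ ⊕ β ⊗ h ⊖ (u ⊕ v)
  gap = begin
    β′ ⊗ (u ⊖ β) ⊗ (v ⊖ β) ⊕ β ⊗ (h ⊖ one)
      ≡⟨ solve (u ∷ v ∷ β ∷ β′ ∷ h ∷ []) ℚ√5-ring ⟩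
    u ⊗ v ⊗ β′ ⊕ β ⊗ h ⊖ (u ⊕ v) ⊗ (β ⊗ β′) ⊕ β ⊗ (β ⊗ β′ ⊖ one)
      ≡⟨ cong (λ r → u ⊗ v ⊗ β′ ⊕ β ⊗ h ⊖ (u ⊕ v) ⊗ r ⊕ β ⊗ (r ⊖ one)) β⊗β′≡1 ⟩
    u ⊗ v ⊗ β′ ⊕ β ⊗ h ⊖ (u ⊕ v) ⊗ one ⊕ β ⊗ (one ⊖ one)
      ≡⟨ solve (u ∷ v ∷ β ∷ β′ ∷ h ∷ []) ℚ√5-ring ⟩
    u ⊗ v ⊗ β′ ⊕ β ⊗ h ⊖ (u ⊕ v)
      ∎

M-term≡ : ∀ A t C a b → M-term A t C (a ℕ.+ b ℕ.+ t)
  ≡ φ ^ a ⊗ φ ^ a ⊗ (φ ^ b ⊗ φ ^ b) ⊗ φ⁻¹ ^ (2 ℕ.* A) ⊕ φ ^ (2 ℕ.* A) ⊗ H-term C (a ℕ.+ b ℕ.+ t)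
M-term≡ A t C a b = cong₂ _⊕_ first second
  where
  c : ℕ
  c = a ℕ.+ b ℕ.+ t
  first : φ^ (ℤ.- + (2 ℕ.* t ℕ.+ 2 ℕ.* A)) ⊗ φ ^ (2 ℕ.* c) ≡ φ ^ a ⊗ φ ^ a ⊗ (φ ^ b ⊗ φ ^ b) ⊗ φ⁻¹ ^ (2 ℕ.* A)
  first = begin
    φ^ (ℤ.- + (2 ℕ.* t ℕ.+ 2 ℕ.* A)) ⊗ φ ^ (2 ℕ.* c)
      ≡⟨ cong₂ _⊗_ φ^-[2t+2A] (φ^-double-+-+ a b t) ⟩
    (φ⁻¹ ^ t ⊗ φ⁻¹ ^ t ⊗ φ⁻¹ ^ (2 ℕ.* A)) ⊗ ((φ ^ a ⊗ φ ^ b ⊗ φ ^ t) ⊗ (φ ^ a ⊗ φ ^ b ⊗ φ ^ t))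
      ≡⟨ T′²β′⊗Z²≡X²Y²β′ (φ ^ a) (φ ^ b) (φ ^ t) (φ⁻¹ ^ t) (φ⁻¹ ^ (2 ℕ.* A)) (φ^⊗φ⁻¹^ t) ⟩
    φ ^ a ⊗ φ ^ a ⊗ (φ ^ b ⊗ φ ^ b) ⊗ φ⁻¹ ^ (2 ℕ.* A)
      ∎
    where
    open ≡-Reasoning
    φ^-[2t+2A] : φ^ (ℤ.- + (2 ℕ.* t ℕ.+ 2 ℕ.* A)) ≡ φ⁻¹ ^ t ⊗ φ⁻¹ ^ t ⊗ φ⁻¹ ^ (2 ℕ.* A)
    φ^-[2t+2A] = trans (φ^-neg (2 ℕ.* t ℕ.+ 2 ℕ.* A))
                       (trans (^-+ φ⁻¹ (2 ℕ.* t) (2 ℕ.* A)) (cong (_⊗ φ⁻¹ ^ (2 ℕ.* A)) (^-double φ⁻¹ t)))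
  second : φ^ (+ (2 ℕ.* A) ℤ.- + (2 ℕ.* C)) ⊗ φ ^ (2 ℕ.* c) ≡ φ ^ (2 ℕ.* A) ⊗ H-term C c
  second = begin
    φ^ (+ (2 ℕ.* A) ℤ.- + (2 ℕ.* C)) ⊗ φ ^ (2 ℕ.* c)
      ≡⟨ cong (_⊗ φ ^ (2 ℕ.* c)) (φ^-sub (2 ℕ.* A) (2 ℕ.* C)) ⟩
    φ ^ (2 ℕ.* A) ⊗ φ⁻¹ ^ (2 ℕ.* C) ⊗ φ ^ (2 ℕ.* c)
      ≡⟨ ⊗-assoc (φ ^ (2 ℕ.* A)) (φ⁻¹ ^ (2 ℕ.* C)) (φ ^ (2 ℕ.* c)) ⟩
    φ ^ (2 ℕ.* A) ⊗ (φ⁻¹ ^ (2 ℕ.* C) ⊗ φ ^ (2 ℕ.* c))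
      ≡⟨ cong (λ y → φ ^ (2 ℕ.* A) ⊗ (y ⊗ φ ^ (2 ℕ.* c))) (sym (φ^-neg (2 ℕ.* C))) ⟩
    φ ^ (2 ℕ.* A) ⊗ H-term C c
      ∎
    where open ≡-Reasoning

1≼H-term : ∀ {C c} → C ℕ.≤ c → one ≼ H-term C c
1≼H-term {C} {c} C≤c = begin
  one                                       ≡⟨ trans (sym (φ^⊗φ⁻¹^ (2 ℕ.* C))) (⊗-comm (φ ^ (2 ℕ.* C)) (φ⁻¹ ^ (2 ℕ.* C))) ⟩
  φ⁻¹ ^ (2 ℕ.* C) ⊗ φ ^ (2 ℕ.* C)           ≤⟨ *-monoˡ-≼ (0≼φ⁻¹^ (2 ℕ.* C)) (φ^-mono (ℕP.*-monoʳ-≤ 2 C≤c)) ⟩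
  φ⁻¹ ^ (2 ℕ.* C) ⊗ φ ^ (2 ℕ.* c)           ≡⟨ cong (_⊗ φ ^ (2 ℕ.* c)) (sym (φ^-neg (2 ℕ.* C))) ⟩
  H-term C c                                ∎
  where open ≼-Reasoning

φ²ᴬ≼φ^⊗φ^ : ∀ {A a} → A ℕ.≤ a → φ ^ (2 ℕ.* A) ≼ φ ^ a ⊗ φ ^ a
φ²ᴬ≼φ^⊗φ^ {A} {a} A≤a = subst (φ ^ (2 ℕ.* A) ≼_) (^-double φ a) (φ^-mono (ℕP.*-monoʳ-≤ 2 A≤a))

squares≼M-term : ∀ A t C a b → A ℕ.≤ a → A ℕ.≤ b → C ℕ.≤ a ℕ.+ b ℕ.+ t →
                 φ ^ a ⊗ φ ^ a ⊕ φ ^ b ⊗ φ ^ b ≼ M-term A t C (a ℕ.+ b ℕ.+ t)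
squares≼M-term A t C a b A≤a A≤b C≤c = subst (φ ^ a ⊗ φ ^ a ⊕ φ ^ b ⊗ φ ^ b ≼_) (sym (M-term≡ A t C a b))
  (u⊕v≼uvβ′⊕βh (φ^⊗φ⁻¹^ (2 ℕ.* A)) (0≼φ^ (2 ℕ.* A)) (0≼φ⁻¹^ (2 ℕ.* A))
               (φ²ᴬ≼φ^⊗φ^ A≤a) (φ²ᴬ≼φ^⊗φ^ A≤b) (1≼H-term C≤c))

φ⁻¹^-product-square≼fifth : ∀ a b t → 2 ℕ.≤ a →
                            (φ⁻¹ ^ a ⊗ φ⁻¹ ^ b ⊗ φ⁻¹ ^ t) ⊗ (φ⁻¹ ^ a ⊗ φ⁻¹ ^ b ⊗ φ⁻¹ ^ t) ≼ fifth
φ⁻¹^-product-square≼fifth a b t 2≤a = subst (λ u → u ⊗ u ≼ fifth) (^-+-+ φ⁻¹ a b t)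
  (φ⁻¹^-square≼fifth (a ℕ.+ b ℕ.+ t) (ℕP.≤-trans 2≤a (ℕP.≤-trans (ℕP.m≤m+n a b) (ℕP.m≤m+n (a ℕ.+ b) t))))

⅕-scale : ∀ {x y x′ y′} → x ≡ fifth ⊗ x′ → y ≡ fifth ⊗ y′ → x′ ≼ y′ → x ≤√ y
⅕-scale refl refl x′≼y′ = ≼⇒≤√ (*-monoˡ-≼ {fifth} ≼-decide x′≼y′)

-- Opened only here, since the module Cone uses _+_ and _≤_ of ℚ.
open import Data.Nat using (ℕ; _≤_; _+_)

lemma4p8 : (A C t : ℕ) → 2 ≤ A → 2 ≤ C → 1 ≤ t →
    (a b c : ℕ) → A ≤ a → a ≤ b → c ≡ a + b + t → C ≤ c →
    (L A t C ⊗ fifthφ2 c ≤√ ofℤ (Q a b c)) × (ofℤ (Q a b c) ≤√ U A t C ⊗ fifthφ2 c)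
lemma4p8 A C t 2≤A _ 1≤t a b .(a + b + t) A≤a a≤b refl C≤c =
  ⅕-scale (L-scaled A t C a b) (Q-binet a b t) lower-bound , ⅕-scale (Q-binet a b t) (U-scaled A t C a b) upper-bound
  where
  2≤a : 2 ≤ a
  2≤a = ℕP.≤-trans 2≤A A≤a
  A≤b : A ≤ b
  A≤b = ℕP.≤-trans A≤a a≤b
  open Estimate (φ ^ a) (φ⁻¹ ^ a) (φ ^ b) (φ⁻¹ ^ b) (φ ^ t) (φ⁻¹ ^ t) ((⊝ one) ^ a) ((⊝ one) ^ b) ((⊝ one) ^ t)
    (M-term A t C (a + b + t)) (H-term C (a + b + t))
    (φ^⊗φ⁻¹^ a) (φ^⊗φ⁻¹^ b) (φ^⊗φ⁻¹^ t) (IsSign-^ a) (IsSign-^ b) (IsSign-^ t)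
    (1≼φ^⊗φ^ a) (1≼φ^⊗φ^ b) (1≼3/√5⊗φ^ t 1≤t) (0≼φ⁻¹^ t) (φ⁻¹^≼1 t)
    (φ⁻¹^-square≼fifth a 2≤a) (φ⁻¹^-square≼fifth b (ℕP.≤-trans 2≤a a≤b)) (φ⁻¹^-product-square≼fifth a b t 2≤a)
    (squares≼M-term A t C a b A≤a A≤b C≤c) (1≼H-term C≤c)
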